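{- For $n\ge1$ let $\mathbb{G}_n$ be the weighted multigraph on vertices $v_1,v_1',\dots,v_n,v_n'$ whose edges are: for each $k=1,\dots,n-1$, the four edges $v_kv_{k+1}$, $v_kv_{k+1}'$, $v_k'v_{k+1}$, $v_k'v_{k+1}'$, each with resistance $2^{ -k}$; and two parallel edges between $v_n$ and $v_n'$, each with resistance $2^{ -(n-1)}$. Then its Kirchhoff index is \[K\!f(\mathbb{G}_n)=\frac{17}{6}\,n-6+\frac{2n+9}{3\cdot 2^{n-1}}.\]
   Context: For a connected multigraph whose edges $e$ carry positive resistances $r_e$, the Laplacian $L$ has $L_{uu}=\sum_{e\ni u}1/r_e$ and, for $u\ne v$, $L_{uv}=-\sum_{e \text{ joining } u,v}1/r_e$. The resistance distance between vertices $u,v$ is $\Omega(u,v)=(\mathbf{e}_u-\mathbf{e}_v)^TL^{\dagger}(\mathbf{e}_u-\mathbf{e}_v)$, where $L^\dagger$ is the Moore–Penrose inverse and $\mathbf{e}_u$ the standard basis vector (equivalently, the effective resistance between $u$ and $v$ when the graph is viewed as an electrical network of resistors). The Kirchhoff index is $K\!f=\sum_{\{u,v\}}\Omega(u,v)$, summed over all unordered pairs of distinct vertices. -}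

module Defs where

open import Data.Nat as ℕ using (ℕ; zero; suc)
import Data.Nat.Properties as ℕP
open import Data.Fin using (Fin; zero; suc; toℕ; inject₁; fromℕ; combine; _≟_)
open import Data.Integer using (+_)
open import Data.Rational using (ℚ; 0ℚ; 1ℚ; _+_; _*_; _-_; -_; _/_; 1/_; Positive)
open import Data.Rational.Properties using (pos⇒nonZero; normalize-pos)
open import Data.List using (List; []; _∷_; _++_; map; concatMap; foldr)
open import Data.Bool using (Bool; true; false; if_then_else_)
open import Relation.Nullary using (does)
open import Relation.Binary.PropositionalEquality using (_≡_)

Σ : ∀ {m} → (Fin m → ℚ) → ℚ
Σ {zero}  f = 0ℚ
Σ {suc m} f = f zero + Σ (λ i → f (suc i))

sumℚ : List ℚ → ℚ
sumℚ = foldr _+_ 0ℚ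

Matrix : ℕ → Set
Matrix m = Fin m → Fin m → ℚ

infixl 7 _⊗_
_⊗_ : ∀ {m} → Matrix m → Matrix m → Matrix m
(A ⊗ B) i j = Σ (λ k → A i k * B k j)

transpose : ∀ {m} → Matrix m → Matrix m
transpose A i j = A j i

record IsMoorePenroseInverse {m : ℕ} (A X : Matrix m) : Set where
  field
    penrose₁ : ∀ i j → (A ⊗ X ⊗ A) i j ≡ A i j
    penrose₂ : ∀ i j → (X ⊗ A ⊗ X) i j ≡ X i j
    penrose₃ : ∀ i j → transpose (A ⊗ X) i j ≡ (A ⊗ X) i j
    penrose₄ : ∀ i j → transpose (X ⊗ A) i j ≡ (X ⊗ A) i j

record Edge (m : ℕ) : Set where
  constructor edge
  field
    end₁ end₂  : Fin m
    resistance : ℚ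
    .{{pos}}   : Positive resistance

conductance : ∀ {m} → Edge m → ℚ
conductance (edge _ _ r {{p}}) = (1/ r) {{pos⇒nonZero r {{p}}}}

Multigraph : ℕ → Set
Multigraph m = List (Edge m)

_==_ : ∀ {m} → Fin m → Fin m → Bool
i == j = does (i ≟ j)

incident : ∀ {m} → Fin m → Edge m → Bool
incident u (edge a b _) = (a == u) Data.Bool.∨ (b == u)
  where import Data.Bool

joins : ∀ {m} → Fin m → Fin m → Edge m → Bool
joins u v (edge a b _) =
  ((a == u) Data.Bool.∧ (b == v)) Data.Bool.∨ ((a == v) Data.Bool.∧ (b == u))
  where import Data.Bool

laplacian : ∀ {m} → Multigraph m → Matrix m
laplacian G u v =
  if u == v
  then sumℚ (map (λ e → if incident u e then conductance e else 0ℚ) G)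
  else - sumℚ (map (λ e → if joins u v e then conductance e else 0ℚ) G)

basis : ∀ {m} → Fin m → Fin m → ℚ
basis u i = if u == i then 1ℚ else 0ℚ

resistanceDistance : ∀ {m} → Matrix m → Fin m → Fin m → ℚ
resistanceDistance X u v =
  Σ (λ i → Σ (λ j → d i * X i j * d j))
  where
    d : _ → ℚ
    d i = basis u i - basis v i

kirchhoffIndex : ∀ {m} → Matrix m → ℚ
kirchhoffIndex X =
  Σ (λ u → Σ (λ v →
    if does (toℕ u ℕ.<? toℕ v) then resistanceDistance X u v else 0ℚ))

-- The graph 𝔾_n, for n = suc p ≥ 1, on vertex set Fin (n * 2):
-- v_{k+1} ↦ combine k 0, v'_{k+1} ↦ combine k 1  (k : Fin n).

2^-_ : ℕ → ℚ
2^- k = (+ 1 / (2 ℕ.^ k)) {{ℕP.m^n≢0 2 k}}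

2^-pos : ∀ k → Positive (2^- k)
2^-pos k = normalize-pos 1 (2 ℕ.^ k) {{ℕP.m^n≢0 2 k}}

edge2^- : ∀ {m} → Fin m → Fin m → ℕ → Edge m
edge2^- a b k = edge a b (2^- k) {{2^-pos k}}

vtx : ∀ {n} → Fin n → Fin 2 → Fin (n ℕ.* 2)
vtx k b = combine k b

allFin : ∀ p → List (Fin p)
allFin zero    = []
allFin (suc p) = zero ∷ map suc (allFin p)

𝔾 : (p : ℕ) → Multigraph (suc p ℕ.* 2)
𝔾 p = concatMap rung (allFin p) ++ (top ∷ top ∷ [])
  where
    -- for k = 1,…,n-1 (here k0 = k-1 : Fin p) four edges of resistance 2^{-k}
    rung : Fin p → List (Edge (suc p ℕ.* 2))
    rung k0 =
      let a = inject₁ k0 ; b = suc k0 ; k = suc (toℕ k0) in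
      edge2^- (vtx a zero)       (vtx b zero)       k ∷
      edge2^- (vtx a zero)       (vtx b (suc zero)) k ∷
      edge2^- (vtx a (suc zero)) (vtx b zero)       k ∷
      edge2^- (vtx a (suc zero)) (vtx b (suc zero)) k ∷ []
    -- parallel edge v_n v_n' with resistance 2^{-(n-1)} = 2^{-p}
    top : Edge (suc p ℕ.* 2)
    top = edge2^- (vtx (fromℕ p) zero) (vtx (fromℕ p) (suc zero)) p

{-# OPTIONS --safe #-}
-- The first Penrose equation is all that is needed: if L is symmetric, L X L = L and L ψ = e_u − e_v,
-- then (e_u − e_v)ᵀ X (e_u − e_v) = ψᵀ L X L ψ = ψᵀ L ψ = ψ_u − ψ_v.  Applied to the columns of a grounded
-- potential Φ (L Φ_{·j} = e_j − e_{v₁}) this gives Ω(u,v) = Φ_uu − Φ_uv − Φ_vu + Φ_vv, hence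
-- Kf = N·tr Φ − Σ_{u,v} Φ_uv with N = 2n.
--
-- For 𝔾_n write the vertices as pairs (level K, side b), with v_{K+1} = (K,0) and v′_{K+1} = (K,1).
-- On functions that do not depend on the side, L acts as the Laplacian of the path 0 − 1 − ⋯ − (n−1)
-- with conductance 2^{K+2} between levels K and K+1; on functions sign(b)·τ(K) it acts diagonally,
-- with weight 4 at level 0 and 6·2^K at every other level.  So the grounded potential is explicit,
--   Φ((K,b),(L,b′)) = (1 − 2^{−min(K,L)})/4 + sign(b)·(δ_{LK}·sign(b′) − δ_{0K})/(2·weight(K)),
-- and its trace and entry sum are geometric sums.

module Submission where

open import Defs
open import Level using (0ℓ)
open import Function using (_∘_)
open import Algebra.Bundles using (CommutativeRing)
open import Data.Bool using (Bool; true; false; if_then_else_; _∧_)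
import Data.Bool.Properties as Bool
open import Data.Empty using (⊥-elim)
open import Data.Fin using (Fin; zero; suc; toℕ; inject₁; fromℕ; quotient; remainder; _≟_)
import Data.Fin.Properties as Fin
open import Data.Integer using (+_)
import Data.Integer as ℤ
import Data.Integer.Properties as ℤ
open import Data.List using (List; []; _∷_; _++_; map; concatMap)
open import Data.List.Properties using (map-cong; map-cong-local; map-∘)
open import Data.List.Relation.Unary.All as All using (All; []; _∷_)
open import Data.List.Relation.Unary.All.Properties using (++⁺; concat⁺; map⁺)
open import Data.Nat using (ℕ; zero; suc)
import Data.Nat as ℕ
import Data.Nat.Properties as ℕ
open import Data.Product using (proj₁; proj₂)
open import Data.Rational using (ℚ; 0ℚ; 1ℚ; ½; _+_; _*_; _-_; -_; _/_; 1/_; fromℚᵘ)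
open import Data.Rational.Properties using (+-*-commutativeRing; *-zeroʳ; *-identityʳ; +-identityʳ; +-identityˡ)
import Data.Rational.Properties as ℚ
open import Data.Rational.Unnormalised using (mkℚᵘ; *≡*)
import Data.Rational.Unnormalised as ℚᵘ
import Data.Rational.Unnormalised.Properties as ℚᵘ
open import Data.Sum using (_⊎_; inj₁; inj₂)
open import Data.Vec.Functional using (Vector)
open import Relation.Binary.Definitions using (Tri; tri<; tri≈; tri>)
open import Relation.Binary.PropositionalEquality
open import Relation.Nullary using (Dec; does; yes; no; ¬_)
open import Relation.Nullary.Decidable using (dec-true; dec-false; dec⇒maybe)
open import Tactic.RingSolver using (solve-∀)
open import Tactic.RingSolver.Core.AlmostCommutativeRing using (AlmostCommutativeRing; fromCommutativeRing)
open import Algebra.Properties.Semiring.Sum (CommutativeRing.semiring +-*-commutativeRing)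
  using (sum; sum-cong-≗; sum-replicate-zero; sum-init-last; ∑-distrib-+; ∑-comm; *-distribˡ-sum; *-distribʳ-sum)

open ≡-Reasoning

ℚ-ring : AlmostCommutativeRing 0ℓ 0ℓ
ℚ-ring = fromCommutativeRing +-*-commutativeRing (λ x → dec⇒maybe (0ℚ ℚ.≟ x))

fromℚᵘ-homo-+ : ∀ p q → fromℚᵘ (p ℚᵘ.+ q) ≡ fromℚᵘ p + fromℚᵘ q
fromℚᵘ-homo-+ p q = ℚ.toℚᵘ-injective (ℚᵘ.≃-trans (ℚ.toℚᵘ-fromℚᵘ (p ℚᵘ.+ q)) (ℚᵘ.≃-sym (ℚᵘ.≃-trans
  (ℚ.toℚᵘ-homo-+ (fromℚᵘ p) (fromℚᵘ q)) (ℚᵘ.+-cong (ℚ.toℚᵘ-fromℚᵘ p) (ℚ.toℚᵘ-fromℚᵘ q)))))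

fromℚᵘ-homo-* : ∀ p q → fromℚᵘ (p ℚᵘ.* q) ≡ fromℚᵘ p * fromℚᵘ q
fromℚᵘ-homo-* p q = ℚ.toℚᵘ-injective (ℚᵘ.≃-trans (ℚ.toℚᵘ-fromℚᵘ (p ℚᵘ.* q)) (ℚᵘ.≃-sym (ℚᵘ.≃-trans
  (ℚ.toℚᵘ-homo-* (fromℚᵘ p) (fromℚᵘ q)) (ℚᵘ.*-cong (ℚ.toℚᵘ-fromℚᵘ p) (ℚ.toℚᵘ-fromℚᵘ q)))))

/1-homo-+ : ∀ m n → + (m ℕ.+ n) / 1 ≡ + m / 1 + + n / 1
/1-homo-+ m n = trans
  (ℚ.fromℚᵘ-cong {mkℚᵘ (+ (m ℕ.+ n)) 0} {mkℚᵘ (+ m) 0 ℚᵘ.+ mkℚᵘ (+ n) 0}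
    (*≡* (cong (ℤ._* + 1) (sym (cong₂ ℤ._+_ (ℤ.*-identityʳ (+ m)) (ℤ.*-identityʳ (+ n)))))))
  (fromℚᵘ-homo-+ (mkℚᵘ (+ m) 0) (mkℚᵘ (+ n) 0))

/1-homo-* : ∀ m n → + (m ℕ.* n) / 1 ≡ (+ m / 1) * (+ n / 1)
/1-homo-* m n = trans
  (ℚ.fromℚᵘ-cong {mkℚᵘ (+ (m ℕ.* n)) 0} {mkℚᵘ (+ m) 0 ℚᵘ.* mkℚᵘ (+ n) 0}
    (*≡* (cong (ℤ._* + 1) (ℤ.pos-* m n))))
  (fromℚᵘ-homo-* (mkℚᵘ (+ m) 0) (mkℚᵘ (+ n) 0))

/3≡/1*⅓ : ∀ n → + n / 3 ≡ (+ n / 1) * (+ 1 / 3)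
/3≡/1*⅓ n = trans
  (ℚ.fromℚᵘ-cong {mkℚᵘ (+ n) 2} {mkℚᵘ (+ n) 0 ℚᵘ.* mkℚᵘ (+ 1) 2}
    (*≡* (cong (ℤ._* + 3) (sym (ℤ.*-identityʳ (+ n))))))
  (fromℚᵘ-homo-* (mkℚᵘ (+ n) 0) (mkℚᵘ (+ 1) 2))

2^-suc : ∀ k → 2^- (suc k) ≡ ½ * 2^- k
2^-suc k = begin
  2^- (suc k)
    ≡⟨ ℚ./-cong {+ 1} {2 ℕ.^ suc k} {+ 1} {2 ℕ.* suc d} {{ℕ.m^n≢0 2 (suc k)}} refl (cong (2 ℕ.*_) 2^k≡1+d) ⟩
  + 1 / (2 ℕ.* suc d)
    ≡⟨ fromℚᵘ-homo-* (mkℚᵘ (+ 1) 1) (mkℚᵘ (+ 1) d) ⟩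
  ½ * (+ 1 / suc d)
    ≡⟨ cong (½ *_) (ℚ./-cong {+ 1} {2 ℕ.^ k} {+ 1} {suc d} {{ℕ.m^n≢0 2 k}} refl 2^k≡1+d) ⟨
  ½ * 2^- k ∎
  where
  d = ℕ.pred (2 ℕ.^ k)
  2^k≡1+d : 2 ℕ.^ k ≡ suc d
  2^k≡1+d = sym (ℕ.suc-pred (2 ℕ.^ k) {{ℕ.m^n≢0 2 k}})

-- Definitionally the conductance of every edge `edge2^- a b k`.
2^_ : ℕ → ℚ
2^ k = (1/ 2^- k) {{ℚ.pos⇒nonZero (2^- k) {{2^-pos k}}}}

2^-*2^ : ∀ k → 2^- k * 2^ k ≡ 1ℚ
2^-*2^ k = ℚ.*-inverseʳ (2^- k) {{ℚ.pos⇒nonZero (2^- k) {{2^-pos k}}}}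

2^suc : ∀ k → 2^ suc k ≡ (+ 2 / 1) * 2^ k
2^suc k = begin
  2^ suc k                                      ≡⟨ trans (cong (2^ suc k *_) (2^-*2^ k)) (*-identityʳ (2^ suc k)) ⟨
  2^ suc k * (2^- k * 2^ k)                     ≡⟨ cong (λ h → 2^ suc k * (h * 2^ k)) (double-half (2^- k)) ⟩
  2^ suc k * (((+ 2 / 1) * (½ * 2^- k)) * 2^ k) ≡⟨ cong (λ h → 2^ suc k * (((+ 2 / 1) * h) * 2^ k)) (2^-suc k) ⟨
  2^ suc k * (((+ 2 / 1) * 2^- suc k) * 2^ k)   ≡⟨ regroup (2^ suc k) (2^- suc k) (2^ k) ⟩
  (+ 2 / 1) * (2^- suc k * 2^ suc k) * 2^ k     ≡⟨ cong (λ x → (+ 2 / 1) * x * 2^ k) (2^-*2^ (suc k)) ⟩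
  (+ 2 / 1) * 1ℚ * 2^ k                         ≡⟨ cong (_* 2^ k) (*-identityʳ (+ 2 / 1)) ⟩
  (+ 2 / 1) * 2^ k                              ∎
  where
  double-half : ∀ h → h ≡ (+ 2 / 1) * (½ * h)
  double-half = solve-∀ ℚ-ring
  regroup : ∀ c h c′ → c * (((+ 2 / 1) * h) * c′) ≡ (+ 2 / 1) * (h * c) * c′
  regroup = solve-∀ ℚ-ring

Σ≡sum : ∀ {m} (f : Fin m → ℚ) → Σ f ≡ sum f
Σ≡sum {zero}  f = refl
Σ≡sum {suc m} f = cong (_+_ (f zero)) (Σ≡sum (f ∘ suc))

∑-distrib-- : ∀ {m} (f g : Vector ℚ m) → sum (λ i → f i - g i) ≡ sum f - sum g
∑-distrib-- {zero}  f g = refl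
∑-distrib-- {suc m} f g = begin
  (f zero - g zero) + sum (λ i → f (suc i) - g (suc i))
    ≡⟨ cong (_+_ (f zero - g zero)) (∑-distrib-- (f ∘ suc) (g ∘ suc)) ⟩
  (f zero - g zero) + (sum (f ∘ suc) - sum (g ∘ suc))
    ≡⟨ lemma (f zero) (g zero) _ _ ⟩
  (f zero + sum (f ∘ suc)) - (g zero + sum (g ∘ suc)) ∎
  where
  lemma : ∀ a b c d → (a - b) + (c - d) ≡ (a + c) - (b + d)
  lemma = solve-∀ ℚ-ring

∑-const : ∀ m (x : ℚ) → sum {m} (λ _ → x) ≡ (+ m / 1) * x
∑-const zero    x = sym (ℚ.*-zeroˡ x)
∑-const (suc m) x = begin
  x + sum {m} (λ _ → x)       ≡⟨ cong (_+_ x) (∑-const m x) ⟩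
  x + (+ m / 1) * x           ≡⟨ lemma x (+ m / 1) ⟩
  (1ℚ + + m / 1) * x          ≡⟨ cong (_* x) (/1-homo-+ 1 m) ⟨
  (+ suc m / 1) * x           ∎
  where
  lemma : ∀ x y → x + y * x ≡ (1ℚ + y) * x
  lemma = solve-∀ ℚ-ring

∑-*-basis : ∀ {m} (ψ : Vector ℚ m) (u : Fin m) → sum (λ i → ψ i * basis u i) ≡ ψ u
∑-*-basis {suc m} ψ zero = begin
  ψ zero * 1ℚ + sum (λ i → ψ (suc i) * 0ℚ)
    ≡⟨ cong₂ _+_ (*-identityʳ (ψ zero)) (sum-cong-≗ (λ i → *-zeroʳ (ψ (suc i)))) ⟩
  ψ zero + sum {m} (λ _ → 0ℚ)
    ≡⟨ cong (_+_ (ψ zero)) (sum-replicate-zero m) ⟩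
  ψ zero + 0ℚ
    ≡⟨ +-identityʳ _ ⟩
  ψ zero ∎
∑-*-basis {suc m} ψ (suc u) = begin
  ψ zero * 0ℚ + sum (λ i → ψ (suc i) * basis u i)
    ≡⟨ cong (_+ sum (λ i → ψ (suc i) * basis u i)) (*-zeroʳ (ψ zero)) ⟩
  0ℚ + sum (λ i → ψ (suc i) * basis u i)
    ≡⟨ +-identityˡ _ ⟩
  sum (λ i → ψ (suc i) * basis u i)
    ≡⟨ ∑-*-basis (ψ ∘ suc) u ⟩
  ψ (suc u) ∎

∑∑-symmetrize : ∀ {m} (F : Fin m → Fin m → ℚ) →
  sum (λ u → sum (λ v → F u v + F v u)) ≡ sum (λ u → sum (F u)) + sum (λ u → sum (F u))
∑∑-symmetrize F = begin
  sum (λ u → sum (λ v → F u v + F v u))             ≡⟨ sum-cong-≗ (λ u → ∑-distrib-+ (F u) (λ v → F v u)) ⟩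
  sum (λ u → sum (F u) + sum (λ v → F v u))         ≡⟨ ∑-distrib-+ (λ u → sum (F u)) (λ u → sum (λ v → F v u)) ⟩
  sum (λ u → sum (F u)) + sum (λ u → sum (λ v → F v u)) ≡⟨ cong (_+_ (sum (λ u → sum (F u)))) (∑-comm F) ⟨
  sum (λ u → sum (F u)) + sum (λ u → sum (F u))     ∎

∑-upper-triangle : ∀ {m} (W : Fin m → Fin m → ℚ) →
  (∀ u v → W u v ≡ W v u) → (∀ u → W u u ≡ 0ℚ) →
  sum (λ u → sum (λ v → if does (toℕ u ℕ.<? toℕ v) then W u v else 0ℚ)) ≡ ½ * sum (λ u → sum (λ v → W u v))
∑-upper-triangle W W-symmetric W-diagonal = begin
  ∑∑T                                           ≡⟨ lemma ∑∑T ⟩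
  ½ * (∑∑T + ∑∑T)                               ≡⟨ cong (½ *_) (∑∑-symmetrize T) ⟨
  ½ * sum (λ u → sum (λ v → T u v + T v u))     ≡⟨ cong (½ *_) (sum-cong-≗ (λ u → sum-cong-≗ (T+Tᵀ≡W u))) ⟩
  ½ * sum (λ u → sum (λ v → W u v))             ∎
  where
  T : Fin _ → Fin _ → ℚ
  T u v = if does (toℕ u ℕ.<? toℕ v) then W u v else 0ℚ
  ∑∑T = sum (λ u → sum (T u))
  lemma : ∀ x → x ≡ ½ * (x + x)
  lemma = solve-∀ ℚ-ring
  T+Tᵀ≡W : ∀ u v → T u v + T v u ≡ W u v
  T+Tᵀ≡W u v with Fin.<-cmp u v
  ... | tri< u<v _ _ rewrite dec-true (toℕ u ℕ.<? toℕ v) u<v | dec-false (toℕ v ℕ.<? toℕ u) (Fin.<-asym u<v)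
      = +-identityʳ (W u v)
  ... | tri> _ _ v<u rewrite dec-false (toℕ u ℕ.<? toℕ v) (Fin.<-asym v<u) | dec-true (toℕ v ℕ.<? toℕ u) v<u
      = trans (+-identityˡ (W v u)) (W-symmetric v u)
  ... | tri≈ _ refl _ rewrite dec-false (toℕ u ℕ.<? toℕ u) (Fin.<-irrefl refl)
      = trans (+-identityʳ 0ℚ) (sym (W-diagonal u))

-- Resistance distance and grounded potentials

infixr 7 _*ᵥ_

_*ᵥ_ : ∀ {m} → Matrix m → Vector ℚ m → Vector ℚ m
(A *ᵥ x) i = sum (λ j → A i j * x j)

⟨_,_⟩ : ∀ {m} → Vector ℚ m → Vector ℚ m → ℚ
⟨ x , y ⟩ = sum (λ i → x i * y i)

*ᵥ-distrib-- : ∀ {m} (A : Matrix m) (x y : Vector ℚ m) i →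
               (A *ᵥ (λ j → x j - y j)) i ≡ (A *ᵥ x) i - (A *ᵥ y) i
*ᵥ-distrib-- A x y i = begin
  sum (λ j → A i j * (x j - y j))       ≡⟨ sum-cong-≗ (λ j → lemma (A i j) (x j) (y j)) ⟩
  sum (λ j → A i j * x j - A i j * y j) ≡⟨ ∑-distrib-- (λ j → A i j * x j) (λ j → A i j * y j) ⟩
  (A *ᵥ x) i - (A *ᵥ y) i               ∎
  where
  lemma : ∀ a x y → a * (x - y) ≡ a * x - a * y
  lemma = solve-∀ ℚ-ring

*ᵥ-distrib-+ : ∀ {m} (A : Matrix m) (x y : Vector ℚ m) i →
               (A *ᵥ (λ j → x j + y j)) i ≡ (A *ᵥ x) i + (A *ᵥ y) i
*ᵥ-distrib-+ A x y i = trans (sum-cong-≗ (λ j → ℚ.*-distribˡ-+ (A i j) (x j) (y j)))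
                            (∑-distrib-+ (λ j → A i j * x j) (λ j → A i j * y j))

⊗-*ᵥ : ∀ {m} (A B : Matrix m) (x : Vector ℚ m) i → ((A ⊗ B) *ᵥ x) i ≡ (A *ᵥ B *ᵥ x) i
⊗-*ᵥ A B x i = begin
  sum (λ j → Σ (λ k → A i k * B k j) * x j)
    ≡⟨ sum-cong-≗ (λ j → cong (_* x j) (Σ≡sum (λ k → A i k * B k j))) ⟩
  sum (λ j → sum (λ k → A i k * B k j) * x j)
    ≡⟨ sum-cong-≗ (λ j → *-distribʳ-sum (x j) (λ k → A i k * B k j)) ⟩
  sum (λ j → sum (λ k → A i k * B k j * x j))
    ≡⟨ ∑-comm (λ j k → A i k * B k j * x j) ⟩
  sum (λ k → sum (λ j → A i k * B k j * x j))
    ≡⟨ sum-cong-≗ (λ k → sum-cong-≗ (λ j → ℚ.*-assoc (A i k) (B k j) (x j))) ⟩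
  sum (λ k → sum (λ j → A i k * (B k j * x j)))
    ≡⟨ sum-cong-≗ (λ k → *-distribˡ-sum (A i k) (λ j → B k j * x j)) ⟨
  sum (λ k → A i k * sum (λ j → B k j * x j)) ∎

⟨*ᵥ,⟩ : ∀ {m} (A : Matrix m) (x y : Vector ℚ m) → ⟨ A *ᵥ x , y ⟩ ≡ ⟨ x , transpose A *ᵥ y ⟩
⟨*ᵥ,⟩ A x y = begin
  sum (λ i → sum (λ j → A i j * x j) * y i)   ≡⟨ sum-cong-≗ (λ i → *-distribʳ-sum (y i) (λ j → A i j * x j)) ⟩
  sum (λ i → sum (λ j → A i j * x j * y i))   ≡⟨ ∑-comm (λ i j → A i j * x j * y i) ⟩
  sum (λ j → sum (λ i → A i j * x j * y i))   ≡⟨ sum-cong-≗ (λ j → sum-cong-≗ (λ i → lemma (A i j) (x j) (y i))) ⟩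
  sum (λ j → sum (λ i → x j * (A i j * y i))) ≡⟨ sum-cong-≗ (λ j → *-distribˡ-sum (x j) (λ i → A i j * y i)) ⟨
  sum (λ j → x j * sum (λ i → A i j * y i))   ∎
  where
  lemma : ∀ a x y → a * x * y ≡ x * (a * y)
  lemma = solve-∀ ℚ-ring

⟨,basis-basis⟩ : ∀ {m} (ψ : Vector ℚ m) u v → ⟨ ψ , (λ i → basis u i - basis v i) ⟩ ≡ ψ u - ψ v
⟨,basis-basis⟩ ψ u v = begin
  sum (λ i → ψ i * (basis u i - basis v i))
    ≡⟨ sum-cong-≗ (λ i → lemma (ψ i) (basis u i) (basis v i)) ⟩
  sum (λ i → ψ i * basis u i - ψ i * basis v i)
    ≡⟨ ∑-distrib-- (λ i → ψ i * basis u i) (λ i → ψ i * basis v i) ⟩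
  sum (λ i → ψ i * basis u i) - sum (λ i → ψ i * basis v i)
    ≡⟨ cong₂ _-_ (∑-*-basis ψ u) (∑-*-basis ψ v) ⟩
  ψ u - ψ v ∎
  where
  lemma : ∀ a x y → a * (x - y) ≡ a * x - a * y
  lemma = solve-∀ ℚ-ring

trace : ∀ {m} → Matrix m → ℚ
trace A = sum (λ u → A u u)

sumEntries : ∀ {m} → Matrix m → ℚ
sumEntries A = sum (λ u → sum (A u))

resistanceDistance≡⟨,*ᵥ⟩ : ∀ {m} (X : Matrix m) u v →
  let d = λ i → basis u i - basis v i in resistanceDistance X u v ≡ ⟨ d , X *ᵥ d ⟩
resistanceDistance≡⟨,*ᵥ⟩ X u v = begin
  Σ (λ i → Σ (λ j → d i * X i j * d j))
    ≡⟨ Σ≡sum (λ i → Σ (λ j → d i * X i j * d j)) ⟩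
  sum (λ i → Σ (λ j → d i * X i j * d j))
    ≡⟨ sum-cong-≗ (λ i → Σ≡sum (λ j → d i * X i j * d j)) ⟩
  sum (λ i → sum (λ j → d i * X i j * d j))
    ≡⟨ sum-cong-≗ (λ i → sum-cong-≗ (λ j → ℚ.*-assoc (d i) (X i j) (d j))) ⟩
  sum (λ i → sum (λ j → d i * (X i j * d j)))
    ≡⟨ sum-cong-≗ (λ i → *-distribˡ-sum (d i) (λ j → X i j * d j)) ⟨
  ⟨ d , X *ᵥ d ⟩ ∎
  where
  d = λ i → basis u i - basis v i

½∑∑-grounded : ∀ {m} (Φ : Matrix m) →
  ½ * sum (λ u → sum (λ v → (Φ u u - Φ u v) - (Φ v u - Φ v v))) ≡ (+ m / 1) * trace Φ - sumEntries Φ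
½∑∑-grounded {m} Φ = begin
  ½ * sum (λ u → sum (λ v → (Φ u u - Φ u v) - (Φ v u - Φ v v)))
    ≡⟨ cong (½ *_) (sum-cong-≗ (λ u → sum-cong-≗ (λ v → lemma₁ (Φ u u) (Φ u v) (Φ v u) (Φ v v)))) ⟩
  ½ * sum (λ u → sum (λ v → D u v + D v u))
    ≡⟨ cong (½ *_) (∑∑-symmetrize D) ⟩
  ½ * (sumEntries D + sumEntries D)
    ≡⟨ lemma₂ (sumEntries D) ⟩
  sumEntries D
    ≡⟨ sum-cong-≗ (λ u → ∑-distrib-- (λ _ → Φ u u) (Φ u)) ⟩
  sum (λ u → sum {m} (λ _ → Φ u u) - sum (Φ u))
    ≡⟨ ∑-distrib-- (λ u → sum {m} (λ _ → Φ u u)) (λ u → sum (Φ u)) ⟩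
  sum (λ u → sum {m} (λ _ → Φ u u)) - sumEntries Φ
    ≡⟨ cong (_- sumEntries Φ) (sum-cong-≗ (λ u → ∑-const m (Φ u u))) ⟩
  sum (λ u → (+ m / 1) * Φ u u) - sumEntries Φ
    ≡⟨ cong (_- sumEntries Φ) (*-distribˡ-sum (+ m / 1) (λ u → Φ u u)) ⟨
  (+ m / 1) * trace Φ - sumEntries Φ ∎
  where
  D : Matrix m
  D u v = Φ u u - Φ u v
  lemma₁ : ∀ a b c d → (a - b) - (c - d) ≡ (a - b) + (d - c)
  lemma₁ = solve-∀ ℚ-ring
  lemma₂ : ∀ x → ½ * (x + x) ≡ x
  lemma₂ = solve-∀ ℚ-ring

module _ {m} {L X : Matrix m} (L-symmetric : ∀ i j → L i j ≡ L j i)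
         (LXL≡L : ∀ i j → (L ⊗ X ⊗ L) i j ≡ L i j) where

  resistanceDistance-potential : ∀ (ψ : Vector ℚ m) u v →
    (∀ i → (L *ᵥ ψ) i ≡ basis u i - basis v i) → resistanceDistance X u v ≡ ψ u - ψ v
  resistanceDistance-potential ψ u v Lψ≡d = begin
    resistanceDistance X u v          ≡⟨ resistanceDistance≡⟨,*ᵥ⟩ X u v ⟩
    ⟨ d , X *ᵥ d ⟩                    ≡⟨ sum-cong-≗ (λ i → cong₂ _*_ (sym (Lψ≡d i))
                                          (sum-cong-≗ (λ j → cong (X i j *_) (sym (Lψ≡d j))))) ⟩
    ⟨ L *ᵥ ψ , X *ᵥ L *ᵥ ψ ⟩          ≡⟨ ⟨*ᵥ,⟩ L ψ (X *ᵥ L *ᵥ ψ) ⟩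
    ⟨ ψ , transpose L *ᵥ X *ᵥ L *ᵥ ψ ⟩ ≡⟨ sum-cong-≗ (λ i → cong (ψ i *_) (LᵀXL≡L i)) ⟩
    ⟨ ψ , L *ᵥ ψ ⟩                    ≡⟨ sum-cong-≗ (λ i → cong (ψ i *_) (Lψ≡d i)) ⟩
    ⟨ ψ , d ⟩                         ≡⟨ ⟨,basis-basis⟩ ψ u v ⟩
    ψ u - ψ v                         ∎
    where
    d = λ i → basis u i - basis v i
    LᵀXL≡L : ∀ i → (transpose L *ᵥ X *ᵥ L *ᵥ ψ) i ≡ (L *ᵥ ψ) i
    LᵀXL≡L i = begin
      (transpose L *ᵥ X *ᵥ L *ᵥ ψ) i ≡⟨ sum-cong-≗ (λ j → cong (_* (X *ᵥ L *ᵥ ψ) j) (L-symmetric j i)) ⟩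
      (L *ᵥ X *ᵥ L *ᵥ ψ) i           ≡⟨ ⊗-*ᵥ L X (L *ᵥ ψ) i ⟨
      ((L ⊗ X) *ᵥ L *ᵥ ψ) i          ≡⟨ ⊗-*ᵥ (L ⊗ X) L ψ i ⟨
      ((L ⊗ X ⊗ L) *ᵥ ψ) i           ≡⟨ sum-cong-≗ (λ j → cong (_* ψ j) (LXL≡L i j)) ⟩
      (L *ᵥ ψ) i                     ∎

  module _ (Φ : Matrix m) (r : Fin m)
           (Φ-grounded : ∀ j i → (L *ᵥ (λ a → Φ a j)) i ≡ basis j i - basis r i) where

    resistanceDistance-grounded : ∀ u v → resistanceDistance X u v ≡ (Φ u u - Φ u v) - (Φ v u - Φ v v)
    resistanceDistance-grounded u v = resistanceDistance-potential (λ a → Φ a u - Φ a v) u v Lψ≡d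
      where
      Lψ≡d : ∀ i → (L *ᵥ (λ a → Φ a u - Φ a v)) i ≡ basis u i - basis v i
      Lψ≡d i = begin
        (L *ᵥ (λ a → Φ a u - Φ a v)) i                   ≡⟨ *ᵥ-distrib-- L (λ a → Φ a u) (λ a → Φ a v) i ⟩
        (L *ᵥ (λ a → Φ a u)) i - (L *ᵥ (λ a → Φ a v)) i ≡⟨ cong₂ _-_ (Φ-grounded u i) (Φ-grounded v i) ⟩
        (basis u i - basis r i) - (basis v i - basis r i) ≡⟨ lemma (basis u i) (basis v i) (basis r i) ⟩
        basis u i - basis v i                             ∎
        where
        lemma : ∀ x y z → (x - z) - (y - z) ≡ x - y
        lemma = solve-∀ ℚ-ring

    kirchhoffIndex-grounded : kirchhoffIndex X ≡ (+ m / 1) * trace Φ - sumEntries Φ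
    kirchhoffIndex-grounded = begin
      kirchhoffIndex X                    ≡⟨ Σ≡sum (λ u → Σ (Ω< u)) ⟩
      sum (λ u → Σ (λ v → Ω< u v))       ≡⟨ sum-cong-≗ (λ u → Σ≡sum (Ω< u)) ⟩
      sum (λ u → sum (λ v → Ω< u v))     ≡⟨ sum-cong-≗ (λ u → sum-cong-≗ (λ v →
                                              cong (λ x → if does (toℕ u ℕ.<? toℕ v) then x else 0ℚ)
                                                   (resistanceDistance-grounded u v))) ⟩
      sum (λ u → sum (λ v → W< u v))     ≡⟨ ∑-upper-triangle W W-symmetric W-diagonal ⟩
      ½ * sum (λ u → sum (λ v → W u v))  ≡⟨ ½∑∑-grounded Φ ⟩
      (+ m / 1) * trace Φ - sumEntries Φ ∎
      where
      Ω< W W< : Fin m → Fin m → ℚ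
      Ω< u v = if does (toℕ u ℕ.<? toℕ v) then resistanceDistance X u v else 0ℚ
      W u v = (Φ u u - Φ u v) - (Φ v u - Φ v v)
      W< u v = if does (toℕ u ℕ.<? toℕ v) then W u v else 0ℚ
      W-symmetric : ∀ u v → W u v ≡ W v u
      W-symmetric u v = lemma (Φ u u) (Φ u v) (Φ v u) (Φ v v)
        where
        lemma : ∀ a b c d → (a - b) - (c - d) ≡ (d - c) - (b - a)
        lemma = solve-∀ ℚ-ring
      W-diagonal : ∀ u → W u u ≡ 0ℚ
      W-diagonal u = lemma (Φ u u)
        where
        lemma : ∀ a → (a - a) - (a - a) ≡ 0ℚ
        lemma = solve-∀ ℚ-ring

𝟙 : Bool → ℚ
𝟙 b = if b then 1ℚ else 0ℚ

𝟙-yes : ∀ {P : Set} (d : Dec P) → P → 𝟙 (does d) ≡ 1ℚ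
𝟙-yes d p = cong 𝟙 (dec-true d p)

𝟙-no : ∀ {P : Set} (d : Dec P) → ¬ P → 𝟙 (does d) ≡ 0ℚ
𝟙-no d ¬p = cong 𝟙 (dec-false d ¬p)

neg≡*-1 : ∀ c → - c ≡ c * - 1ℚ
neg≡*-1 = solve-∀ ℚ-ring

Loopless : ∀ {m} → Edge m → Set
Loopless e = Edge.end₁ e ≢ Edge.end₂ e

edgeLaplacian : ∀ {m} → Edge m → Matrix m
edgeLaplacian e u v =
  if u == v then (if incident u e then conductance e else 0ℚ) else - (if joins u v e then conductance e else 0ℚ)

edgeLaplacian-loopless : ∀ {m} (e : Edge m) → Loopless e → ∀ u v → let open Edge e in
  edgeLaplacian e u v ≡ conductance e * ((𝟙 (end₁ == u) - 𝟙 (end₂ == u)) * (𝟙 (end₁ == v) - 𝟙 (end₂ == v)))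
edgeLaplacian-loopless e@(edge a b _) a≢b u v with u ≟ v
... | yes refl with a ≟ u | b ≟ u
...   | yes a≡u | yes b≡u = ⊥-elim (a≢b (trans a≡u (sym b≡u)))
...   | yes _   | no _    = sym (*-identityʳ (conductance e))
...   | no _    | yes _   = sym (*-identityʳ (conductance e))
...   | no _    | no _    = sym (*-zeroʳ (conductance e))
edgeLaplacian-loopless e@(edge a b _) a≢b u v | no u≢v with a ≟ u | b ≟ u | a ≟ v | b ≟ v
... | yes a≡u | _       | yes a≡v | _       = ⊥-elim (u≢v (trans (sym a≡u) a≡v))
... | _       | yes b≡u | _       | yes b≡v = ⊥-elim (u≢v (trans (sym b≡u) b≡v))
... | yes a≡u | yes b≡u | _       | _       = ⊥-elim (a≢b (trans a≡u (sym b≡u)))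
... | _       | _       | yes a≡v | yes b≡v = ⊥-elim (a≢b (trans a≡v (sym b≡v)))
... | yes _   | no _    | no _    | yes _   = neg≡*-1 (conductance e)
... | no _    | yes _   | yes _   | no _    = neg≡*-1 (conductance e)
... | yes _   | no _    | no _    | no _    = sym (*-zeroʳ (conductance e))
... | no _    | yes _   | no _    | no _    = sym (*-zeroʳ (conductance e))
... | no _    | no _    | yes _   | no _    = sym (*-zeroʳ (conductance e))
... | no _    | no _    | no _    | yes _   = sym (*-zeroʳ (conductance e))
... | no _    | no _    | no _    | no _    = sym (*-zeroʳ (conductance e))

sumℚ-map-neg : ∀ {A : Set} (f : A → ℚ) xs → - sumℚ (map f xs) ≡ sumℚ (map (-_ ∘ f) xs)
sumℚ-map-neg f []       = refl
sumℚ-map-neg f (x ∷ xs) = trans (ℚ.neg-distrib-+ (f x) _) (cong (_+_ (- f x)) (sumℚ-map-neg f xs))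

laplacian≡∑edgeLaplacian : ∀ {m} (G : Multigraph m) u v → laplacian G u v ≡ sumℚ (map (λ e → edgeLaplacian e u v) G)
laplacian≡∑edgeLaplacian G u v with u == v
... | true  = refl
... | false = sumℚ-map-neg (λ e → if joins u v e then conductance e else 0ℚ) G

laplacian-symmetric : ∀ {m} (G : Multigraph m) u v → laplacian G u v ≡ laplacian G v u
laplacian-symmetric G u v with u ≟ v
... | yes refl rewrite dec-true (u ≟ u) refl = refl
... | no u≢v rewrite dec-false (v ≟ u) (u≢v ∘ sym) =
  cong (λ xs → - sumℚ xs) (map-cong (λ e → cong (λ t → if t then conductance e else 0ℚ) (joins-symmetric e)) G)
  where
  joins-symmetric : ∀ e → joins u v e ≡ joins v u e
  joins-symmetric (edge a b _) = Bool.∨-comm ((a == u) ∧ (b == v)) ((a == v) ∧ (b == u))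

∑-sumℚ-comm : ∀ {m} {A : Set} (F : Fin m → A → ℚ) (ψ : Vector ℚ m) xs →
  sum (λ v → sumℚ (map (F v) xs) * ψ v) ≡ sumℚ (map (λ x → sum (λ v → F v x * ψ v)) xs)
∑-sumℚ-comm {m} F ψ [] = trans (sum-cong-≗ (λ v → ℚ.*-zeroˡ (ψ v))) (sum-replicate-zero m)
∑-sumℚ-comm F ψ (x ∷ xs) = begin
  sum (λ v → (F v x + sumℚ (map (F v) xs)) * ψ v)
    ≡⟨ sum-cong-≗ (λ v → ℚ.*-distribʳ-+ (ψ v) (F v x) _) ⟩
  sum (λ v → F v x * ψ v + sumℚ (map (F v) xs) * ψ v)
    ≡⟨ ∑-distrib-+ (λ v → F v x * ψ v) _ ⟩
  sum (λ v → F v x * ψ v) + sum (λ v → sumℚ (map (F v) xs) * ψ v)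
    ≡⟨ cong (_+_ (sum (λ v → F v x * ψ v))) (∑-sumℚ-comm F ψ xs) ⟩
  sum (λ v → F v x * ψ v) + sumℚ (map (λ x → sum (λ v → F v x * ψ v)) xs) ∎

flux : ∀ {m} → Vector ℚ m → Fin m → Edge m → ℚ
flux ψ u e = let open Edge e in conductance e * (𝟙 (end₁ == u) - 𝟙 (end₂ == u)) * (ψ end₁ - ψ end₂)

edgeLaplacian-*ᵥ : ∀ {m} (ψ : Vector ℚ m) u {e : Edge m} → Loopless e →
  sum (λ v → edgeLaplacian e u v * ψ v) ≡ flux ψ u e
edgeLaplacian-*ᵥ ψ u {e@(edge a b _)} a≢b = begin
  sum (λ v → edgeLaplacian e u v * ψ v)
    ≡⟨ sum-cong-≗ (λ v → cong (_* ψ v) (edgeLaplacian-loopless e a≢b u v)) ⟩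
  sum (λ v → c * (εu * (basis a v - basis b v)) * ψ v)
    ≡⟨ sum-cong-≗ (λ v → lemma c εu (basis a v - basis b v) (ψ v)) ⟩
  sum (λ v → c * εu * (ψ v * (basis a v - basis b v)))
    ≡⟨ *-distribˡ-sum (c * εu) (λ v → ψ v * (basis a v - basis b v)) ⟨
  c * εu * ⟨ ψ , (λ v → basis a v - basis b v) ⟩
    ≡⟨ cong (c * εu *_) (⟨,basis-basis⟩ ψ a b) ⟩
  c * εu * (ψ a - ψ b) ∎
  where
  c  = conductance e
  εu = 𝟙 (a == u) - 𝟙 (b == u)
  lemma : ∀ c ε d x → c * (ε * d) * x ≡ c * ε * (x * d)
  lemma = solve-∀ ℚ-ring

laplacian-*ᵥ : ∀ {m} (G : Multigraph m) → All Loopless G → ∀ ψ u →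
  (laplacian G *ᵥ ψ) u ≡ sumℚ (map (flux ψ u) G)
laplacian-*ᵥ G G-loopless ψ u = begin
  sum (λ v → laplacian G u v * ψ v)
    ≡⟨ sum-cong-≗ (λ v → cong (_* ψ v) (laplacian≡∑edgeLaplacian G u v)) ⟩
  sum (λ v → sumℚ (map (λ e → edgeLaplacian e u v) G) * ψ v)
    ≡⟨ ∑-sumℚ-comm (λ v e → edgeLaplacian e u v) ψ G ⟩
  sumℚ (map (λ e → sum (λ v → edgeLaplacian e u v * ψ v)) G)
    ≡⟨ cong sumℚ (map-cong-local (All.map (λ {e} → edgeLaplacian-*ᵥ ψ u {e}) G-loopless)) ⟩
  sumℚ (map (flux ψ u) G) ∎

-- The graph 𝔾 in level coordinates

δ : ℕ → ℕ → ℚ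
δ m n = 𝟙 (does (m ℕ.≟ n))

𝟙-vtx : ∀ {n} (a k : Fin n) (x b : Fin 2) → 𝟙 (vtx a x == vtx k b) ≡ δ (toℕ a) (toℕ k) * 𝟙 (x == b)
𝟙-vtx a k x b with a ≟ k | x ≟ b
... | yes refl | yes refl rewrite dec-true (vtx a x ≟ vtx a x) refl | dec-true (toℕ a ℕ.≟ toℕ a) refl = refl
... | yes refl | no x≢b rewrite dec-false (vtx a x ≟ vtx a b) (x≢b ∘ Fin.combine-injectiveʳ a x a b) =
  sym (*-zeroʳ (δ (toℕ a) (toℕ a)))
... | no a≢k | x≟b rewrite dec-false (vtx a x ≟ vtx k b) (a≢k ∘ Fin.combine-injectiveˡ a x k b)
                         | dec-false (toℕ a ℕ.≟ toℕ k) (a≢k ∘ Fin.toℕ-injective) = sym (ℚ.*-zeroˡ (𝟙 (does x≟b)))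

∑-δ : ∀ n K (F : ℕ → ℚ) → sum {n} (λ i → δ (toℕ i) K * F (toℕ i)) ≡ 𝟙 (does (K ℕ.<? n)) * F K
∑-δ zero    K       F = sym (ℚ.*-zeroˡ (F K))
∑-δ (suc n) zero    F = begin
  1ℚ * F 0 + sum {n} (λ i → 0ℚ * F (suc (toℕ i)))
    ≡⟨ cong (_+_ (1ℚ * F 0)) (sum-cong-≗ (λ (i : Fin n) → ℚ.*-zeroˡ (F (suc (toℕ i))))) ⟩
  1ℚ * F 0 + sum {n} (λ _ → 0ℚ)
    ≡⟨ cong (_+_ (1ℚ * F 0)) (sum-replicate-zero n) ⟩
  1ℚ * F 0 + 0ℚ
    ≡⟨ +-identityʳ (1ℚ * F 0) ⟩
  1ℚ * F 0 ∎
∑-δ (suc n) (suc K) F = begin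
  0ℚ * F 0 + sum {n} (λ i → δ (toℕ i) K * F (suc (toℕ i)))
    ≡⟨ cong (_+ sum {n} (λ i → δ (toℕ i) K * F (suc (toℕ i)))) (ℚ.*-zeroˡ (F 0)) ⟩
  0ℚ + sum {n} (λ i → δ (toℕ i) K * F (suc (toℕ i)))
    ≡⟨ +-identityˡ (sum {n} (λ i → δ (toℕ i) K * F (suc (toℕ i)))) ⟩
  sum {n} (λ i → δ (toℕ i) K * F (suc (toℕ i)))
    ≡⟨ ∑-δ n K (F ∘ suc) ⟩
  𝟙 (does (K ℕ.<? n)) * F (suc K) ∎

sumℚ-++ : ∀ {A : Set} (f : A → ℚ) xs ys → sumℚ (map f (xs ++ ys)) ≡ sumℚ (map f xs) + sumℚ (map f ys)
sumℚ-++ f []       ys = sym (+-identityˡ _)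
sumℚ-++ f (x ∷ xs) ys = trans (cong (_+_ (f x)) (sumℚ-++ f xs ys)) (sym (ℚ.+-assoc (f x) _ _))

sumℚ-concatMap : ∀ {A B : Set} (f : B → ℚ) (g : A → List B) xs →
  sumℚ (map f (concatMap g xs)) ≡ sumℚ (map (λ x → sumℚ (map f (g x))) xs)
sumℚ-concatMap f g []       = refl
sumℚ-concatMap f g (x ∷ xs) =
  trans (sumℚ-++ f (g x) (concatMap g xs)) (cong (_+_ (sumℚ (map f (g x)))) (sumℚ-concatMap f g xs))

sumℚ-allFin : ∀ p (f : Fin p → ℚ) → sumℚ (map f (allFin p)) ≡ sum f
sumℚ-allFin zero    f = refl
sumℚ-allFin (suc p) f = cong (_+_ (f zero)) (trans (cong sumℚ (sym (map-∘ (allFin p)))) (sumℚ-allFin p (f ∘ suc)))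

𝔾-loopless : ∀ p → All Loopless (𝔾 p)
𝔾-loopless p = ++⁺ (concat⁺ (map⁺ (All.universal rung-loopless (allFin p)))) (top-loopless ∷ top-loopless ∷ [])
  where
  rung-edge-loopless : ∀ (k : Fin p) x y → vtx (inject₁ k) x ≢ vtx (suc k) y
  rung-edge-loopless k x y eq = ℕ.1+n≢n (sym (trans (sym (Fin.toℕ-inject₁ k))
    (cong toℕ (Fin.combine-injectiveˡ (inject₁ k) x (suc k) y eq))))
  rung-loopless : ∀ k → All Loopless _
  rung-loopless k = rung-edge-loopless k zero zero ∷ rung-edge-loopless k zero (suc zero)
                  ∷ rung-edge-loopless k (suc zero) zero ∷ rung-edge-loopless k (suc zero) (suc zero) ∷ []
  top-loopless : vtx (fromℕ p) zero ≢ vtx (fromℕ p) (suc zero)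
  top-loopless eq with Fin.combine-injectiveʳ (fromℕ p) zero (fromℕ p) (suc zero) eq
  ... | ()

sign : Fin 2 → ℚ
sign zero       = 1ℚ
sign (suc zero) = - 1ℚ

sign≡𝟙-𝟙 : ∀ b → sign b ≡ 𝟙 (zero == b) - 𝟙 (suc zero == b)
sign≡𝟙-𝟙 zero       = refl
sign≡𝟙-𝟙 (suc zero) = refl

select : ∀ (F : Fin 2 → ℚ) b → 𝟙 (zero == b) * F zero + 𝟙 (suc zero == b) * F (suc zero) ≡ F b
select F zero       = trans (cong₂ _+_ (ℚ.*-identityˡ (F zero)) (ℚ.*-zeroˡ (F (suc zero)))) (+-identityʳ (F zero))
select F (suc zero) = trans (cong₂ _+_ (ℚ.*-zeroˡ (F zero)) (ℚ.*-identityˡ (F (suc zero)))) (+-identityˡ (F (suc zero)))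

spoke : ℚ → (ℕ → Fin 2 → ℚ) → ℕ → ℕ → Fin 2 → ℚ
spoke c Ψ i j b = c * ((Ψ i b - Ψ j zero) + (Ψ i b - Ψ j (suc zero)))

spokeDown : (ℕ → Fin 2 → ℚ) → ℕ → Fin 2 → ℚ
spokeDown Ψ zero    b = 0ℚ
spokeDown Ψ (suc K) b = spoke (2^ suc K) Ψ (suc K) K b

-- (L ψ)(K, b) for ψ given in level coordinates: the flux into level K + 1, into level K − 1, and
-- through the two parallel top edges.
localLaplacian : ℕ → (ℕ → Fin 2 → ℚ) → ℕ → Fin 2 → ℚ
localLaplacian p Ψ K b = 𝟙 (does (K ℕ.<? p)) * spoke (2^ suc K) Ψ K (suc K) b + spokeDown Ψ K b
                       + δ p K * ((2^ p + 2^ p) * (sign b * (Ψ p zero - Ψ p (suc zero))))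

module _ (p : ℕ) (ψ : Vector ℚ (suc p ℕ.* 2)) (Ψ : ℕ → Fin 2 → ℚ)
         (ψ≡Ψ : ∀ (k : Fin (suc p)) x → ψ (vtx k x) ≡ Ψ (toℕ k) x) (k : Fin (suc p)) (b : Fin 2) where

  private
    K = toℕ k
    f = flux ψ (vtx k b)

  flux-vtx : ∀ (a c : Fin (suc p)) x y κ → f (edge2^- (vtx a x) (vtx c y) κ)
    ≡ 2^ κ * (δ (toℕ a) K * 𝟙 (x == b) - δ (toℕ c) K * 𝟙 (y == b)) * (Ψ (toℕ a) x - Ψ (toℕ c) y)
  flux-vtx a c x y κ =
    cong₂ (λ ε Δ → 2^ κ * ε * Δ) (cong₂ _-_ (𝟙-vtx a k x b) (𝟙-vtx c k y b)) (cong₂ _-_ (ψ≡Ψ a x) (ψ≡Ψ c y))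

  rung-flux : ∀ (k₀ : Fin p) → let i = toℕ k₀ ; e = λ x y → edge2^- (vtx (inject₁ k₀) x) (vtx (suc k₀) y) (suc i) in
    f (e zero zero) + (f (e zero (suc zero)) + (f (e (suc zero) zero) + (f (e (suc zero) (suc zero)) + 0ℚ)))
      ≡ δ i K * spoke (2^ suc i) Ψ i (suc i) b + δ (suc i) K * spoke (2^ suc i) Ψ (suc i) i b
  rung-flux k₀ = begin
    _ ≡⟨ cong₂ _+_ (flux-rung zero zero) (cong₂ _+_ (flux-rung zero (suc zero))
           (cong₂ _+_ (flux-rung (suc zero) zero) (cong (_+ 0ℚ) (flux-rung (suc zero) (suc zero))))) ⟩
    _ ≡⟨ expand c (δ i K) (δ (suc i) K) (𝟙 (zero == b)) (𝟙 (suc zero == b))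
                (Ψ i zero) (Ψ i (suc zero)) (Ψ (suc i) zero) (Ψ (suc i) (suc zero)) ⟩
    _ ≡⟨ cong₂ (λ x y → δ i K * (c * x) + δ (suc i) K * (c * y))
               (select (λ x → (Ψ i x - Ψ (suc i) zero) + (Ψ i x - Ψ (suc i) (suc zero))) b)
               (select (λ y → (Ψ (suc i) y - Ψ i zero) + (Ψ (suc i) y - Ψ i (suc zero))) b) ⟩
    _ ∎
    where
    i = toℕ k₀
    c = 2^ suc i
    flux-rung : ∀ x y → f (edge2^- (vtx (inject₁ k₀) x) (vtx (suc k₀) y) (suc i))
                        ≡ c * (δ i K * 𝟙 (x == b) - δ (suc i) K * 𝟙 (y == b)) * (Ψ i x - Ψ (suc i) y)
    flux-rung x y = trans (flux-vtx (inject₁ k₀) (suc k₀) x y (suc i))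
      (cong (λ j → c * (δ j K * 𝟙 (x == b) - δ (suc i) K * 𝟙 (y == b)) * (Ψ j x - Ψ (suc i) y)) (Fin.toℕ-inject₁ k₀))
    expand : ∀ c d d′ e₀ e₁ a₀ a₁ s₀ s₁ →
      c * (d * e₀ - d′ * e₀) * (a₀ - s₀) + (c * (d * e₀ - d′ * e₁) * (a₀ - s₁)
        + (c * (d * e₁ - d′ * e₀) * (a₁ - s₀) + (c * (d * e₁ - d′ * e₁) * (a₁ - s₁) + 0ℚ)))
      ≡ d * (c * (e₀ * ((a₀ - s₀) + (a₀ - s₁)) + e₁ * ((a₁ - s₀) + (a₁ - s₁))))
        + d′ * (c * (e₀ * ((s₀ - a₀) + (s₀ - a₁)) + e₁ * ((s₁ - a₀) + (s₁ - a₁))))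
    expand = solve-∀ ℚ-ring

  top-flux : let top = edge2^- (vtx (fromℕ p) zero) (vtx (fromℕ p) (suc zero)) p in
    f top + (f top + 0ℚ) ≡ δ p K * ((2^ p + 2^ p) * (sign b * (Ψ p zero - Ψ p (suc zero))))
  top-flux = begin
    _ ≡⟨ cong (λ x → x + (x + 0ℚ)) (trans (flux-vtx (fromℕ p) (fromℕ p) zero (suc zero) p)
           (cong (λ j → 2^ p * (δ j K * 𝟙 (zero == b) - δ j K * 𝟙 (suc zero == b)) * (Ψ j zero - Ψ j (suc zero)))
                 (Fin.toℕ-fromℕ p))) ⟩
    _ ≡⟨ lemma (2^ p) (δ p K) (𝟙 (zero == b)) (𝟙 (suc zero == b)) (Ψ p zero - Ψ p (suc zero)) ⟩
    _ ≡⟨ cong (λ s → δ p K * ((2^ p + 2^ p) * (s * (Ψ p zero - Ψ p (suc zero))))) (sign≡𝟙-𝟙 b) ⟨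
    _ ∎
    where
    lemma : ∀ c d e₀ e₁ Δ → c * (d * e₀ - d * e₁) * Δ + (c * (d * e₀ - d * e₁) * Δ + 0ℚ) ≡ d * ((c + c) * ((e₀ - e₁) * Δ))
    lemma = solve-∀ ℚ-ring

  rungs-flux : K ℕ.≤ p → (rung : Fin p → List (Edge (suc p ℕ.* 2))) →
    (∀ k₀ → let i = toℕ k₀ in
      sumℚ (map f (rung k₀)) ≡ δ i K * spoke (2^ suc i) Ψ i (suc i) b + δ (suc i) K * spoke (2^ suc i) Ψ (suc i) i b) →
    sumℚ (map f (concatMap rung (allFin p))) ≡ 𝟙 (does (K ℕ.<? p)) * spoke (2^ suc K) Ψ K (suc K) b + spokeDown Ψ K b
  rungs-flux K≤p rung rung-flux = begin
    sumℚ (map f (concatMap rung (allFin p)))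
      ≡⟨ sumℚ-concatMap f rung (allFin p) ⟩
    sumℚ (map (λ k₀ → sumℚ (map f (rung k₀))) (allFin p))
      ≡⟨ sumℚ-allFin p (λ k₀ → sumℚ (map f (rung k₀))) ⟩
    sum {p} (λ k₀ → sumℚ (map f (rung k₀)))
      ≡⟨ sum-cong-≗ rung-flux ⟩
    sum {p} (λ k₀ → δ (toℕ k₀) K * up (toℕ k₀) + δ (suc (toℕ k₀)) K * down (toℕ k₀))
      ≡⟨ ∑-distrib-+ (λ (k₀ : Fin p) → δ (toℕ k₀) K * up (toℕ k₀)) (λ k₀ → δ (suc (toℕ k₀)) K * down (toℕ k₀)) ⟩
    sum {p} (λ k₀ → δ (toℕ k₀) K * up (toℕ k₀)) + sum {p} (λ k₀ → δ (suc (toℕ k₀)) K * down (toℕ k₀))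
      ≡⟨ cong₂ _+_ (∑-δ p K up) (∑-δ-suc K K≤p) ⟩
    𝟙 (does (K ℕ.<? p)) * up K + spokeDown Ψ K b ∎
    where
    up down : ℕ → ℚ
    up   i = spoke (2^ suc i) Ψ i (suc i) b
    down i = spoke (2^ suc i) Ψ (suc i) i b
    ∑-δ-suc : ∀ K → K ℕ.≤ p → sum {p} (λ k₀ → δ (suc (toℕ k₀)) K * down (toℕ k₀)) ≡ spokeDown Ψ K b
    ∑-δ-suc zero    _   = trans (sum-cong-≗ (λ (k₀ : Fin p) → ℚ.*-zeroˡ (down (toℕ k₀)))) (sum-replicate-zero p)
    ∑-δ-suc (suc K) K<p = begin
      sum {p} (λ k₀ → δ (toℕ k₀) K * down (toℕ k₀)) ≡⟨ ∑-δ p K down ⟩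
      𝟙 (does (K ℕ.<? p)) * down K                  ≡⟨ cong (_* down K) (𝟙-yes (K ℕ.<? p) K<p) ⟩
      1ℚ * down K                                    ≡⟨ ℚ.*-identityˡ (down K) ⟩
      down K                                         ∎

  laplacian-𝔾 : K ℕ.≤ p → (laplacian (𝔾 p) *ᵥ ψ) (vtx k b) ≡ localLaplacian p Ψ K b
  laplacian-𝔾 K≤p = begin
    (laplacian (𝔾 p) *ᵥ ψ) (vtx k b)                        ≡⟨ laplacian-*ᵥ (𝔾 p) (𝔾-loopless p) ψ (vtx k b) ⟩
    sumℚ (map f (𝔾 p))                                      ≡⟨ sumℚ-++ f (concatMap _ (allFin p)) _ ⟩
    sumℚ (map f (concatMap _ (allFin p))) + _               ≡⟨ cong₂ _+_ (rungs-flux K≤p _ rung-flux) top-flux ⟩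
    localLaplacian p Ψ K b                                   ∎

-- Side-symmetric and side-antisymmetric functions

current : (ℕ → ℚ) → ℕ → ℚ
current σ K = (2^ suc K + 2^ suc K) * (σ K - σ (suc K))

pathLaplacian : ℕ → (ℕ → ℚ) → ℕ → ℚ
pathLaplacian p σ zero    = 𝟙 (does (0 ℕ.<? p)) * current σ 0
pathLaplacian p σ (suc K) = 𝟙 (does (suc K ℕ.<? p)) * current σ (suc K) - current σ K

localLaplacian-symmetric : ∀ p (σ : ℕ → ℚ) K b → localLaplacian p (λ K _ → σ K) K b ≡ pathLaplacian p σ K
localLaplacian-symmetric p σ zero b =
  lemma (𝟙 (does (0 ℕ.<? p))) (2^ 1) (σ 0) (σ 1) (δ p 0) (2^ p) (sign b) (σ p)
  where
  lemma : ∀ u c x y d c′ s z → u * (c * ((x - y) + (x - y))) + 0ℚ + d * ((c′ + c′) * (s * (z - z))) ≡ u * ((c + c) * (x - y))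
  lemma = solve-∀ ℚ-ring
localLaplacian-symmetric p σ (suc K) b =
  lemma (𝟙 (does (suc K ℕ.<? p))) (2^ suc (suc K)) (2^ suc K) (σ K) (σ (suc K)) (σ (suc (suc K)))
        (δ p (suc K)) (2^ p) (sign b) (σ p)
  where
  lemma : ∀ u c₁ c₀ w x y d c′ s z →
    u * (c₁ * ((x - y) + (x - y))) + c₀ * ((x - w) + (x - w)) + d * ((c′ + c′) * (s * (z - z)))
    ≡ u * ((c₁ + c₁) * (x - y)) - (c₀ + c₀) * (w - x)
  lemma = solve-∀ ℚ-ring

A : ℕ → ℚ
A t = (1ℚ - 2^- t) * (+ 1 / 4)

current-A : ∀ L K → current (λ t → A (t ℕ.⊓ L)) K ≡ - ½ * 𝟙 (does (K ℕ.<? L))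
current-A L K = by-cases (K ℕ.<? L)
  where
  c = 2^ suc K
  by-cases : Dec (K ℕ.< L) → current (λ t → A (t ℕ.⊓ L)) K ≡ - ½ * 𝟙 (does (K ℕ.<? L))
  by-cases (yes K<L) = begin
    (c + c) * (A (K ℕ.⊓ L) - A (suc K ℕ.⊓ L))
      ≡⟨ cong₂ (λ s t → (c + c) * (A s - A t)) (ℕ.m≤n⇒m⊓n≡m (ℕ.<⇒≤ K<L)) (ℕ.m≤n⇒m⊓n≡m K<L) ⟩
    (c + c) * ((1ℚ - 2^- K) * (+ 1 / 4) - (1ℚ - 2^- suc K) * (+ 1 / 4))
      ≡⟨ cong (λ h → (c + c) * ((1ℚ - 2^- K) * (+ 1 / 4) - (1ℚ - h) * (+ 1 / 4))) (2^-suc K) ⟩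
    (c + c) * ((1ℚ - 2^- K) * (+ 1 / 4) - (1ℚ - ½ * 2^- K) * (+ 1 / 4))
      ≡⟨ lemma c (2^- K) ⟩
    - ½ * ((½ * 2^- K) * c)
      ≡⟨ cong (λ h → - ½ * (h * c)) (2^-suc K) ⟨
    - ½ * (2^- suc K * c)
      ≡⟨ cong (- ½ *_) (2^-*2^ (suc K)) ⟩
    - ½ * 1ℚ
      ≡⟨ cong (- ½ *_) (𝟙-yes (K ℕ.<? L) K<L) ⟨
    - ½ * 𝟙 (does (K ℕ.<? L)) ∎
    where
    lemma : ∀ c h → (c + c) * ((1ℚ - h) * (+ 1 / 4) - (1ℚ - ½ * h) * (+ 1 / 4)) ≡ - ½ * ((½ * h) * c)
    lemma = solve-∀ ℚ-ring
  by-cases (no K≮L) = begin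
    (c + c) * (A (K ℕ.⊓ L) - A (suc K ℕ.⊓ L))
      ≡⟨ cong₂ (λ s t → (c + c) * (A s - A t)) (ℕ.m≥n⇒m⊓n≡n L≤K) (ℕ.m≥n⇒m⊓n≡n (ℕ.m≤n⇒m≤1+n L≤K)) ⟩
    (c + c) * (A L - A L)
      ≡⟨ cong ((c + c) *_) (ℚ.+-inverseʳ (A L)) ⟩
    (c + c) * 0ℚ
      ≡⟨ *-zeroʳ (c + c) ⟩
    0ℚ
      ≡⟨ *-zeroʳ (- ½) ⟨
    - ½ * 0ℚ
      ≡⟨ cong (- ½ *_) (𝟙-no (K ℕ.<? L) K≮L) ⟨
    - ½ * 𝟙 (does (K ℕ.<? L)) ∎
    where
    L≤K = ℕ.≮⇒≥ K≮L

pathLaplacian-A : ∀ p L K → L ℕ.≤ p → pathLaplacian p (λ t → A (t ℕ.⊓ L)) K ≡ ½ * (δ L K - δ 0 K)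
pathLaplacian-A p       zero    zero _ =
  trans (cong (𝟙 (does (0 ℕ.<? p)) *_) (current-A 0 0)) (*-zeroʳ (𝟙 (does (0 ℕ.<? p))))
pathLaplacian-A (suc p) (suc L) zero _ = cong (1ℚ *_) (current-A (suc L) 0)
pathLaplacian-A p L (suc K) L≤p = begin
  u * current σ (suc K) - current σ K ≡⟨ cong₂ (λ x y → u * x - y) (current-A L (suc K)) (current-A L K) ⟩
  u * (- ½ * a) - - ½ * b             ≡⟨ lemma u a b ⟩
  ½ * ((b - u * a) - 0ℚ)              ≡⟨ cong (λ t → ½ * (t - 0ℚ)) (by-cases (ℕ.<-cmp (suc K) L)) ⟩
  ½ * (δ L (suc K) - 0ℚ)              ∎
  where
  σ = λ t → A (t ℕ.⊓ L)
  u = 𝟙 (does (suc K ℕ.<? p))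
  a = 𝟙 (does (suc K ℕ.<? L))
  b = 𝟙 (does (K ℕ.<? L))
  lemma : ∀ u a b → u * (- ½ * a) - - ½ * b ≡ ½ * ((b - u * a) - 0ℚ)
  lemma = solve-∀ ℚ-ring
  1-u*0≡1 : ∀ u → 1ℚ - u * 0ℚ ≡ 1ℚ
  1-u*0≡1 = solve-∀ ℚ-ring
  0-u*0≡0 : ∀ u → 0ℚ - u * 0ℚ ≡ 0ℚ
  0-u*0≡0 = solve-∀ ℚ-ring
  by-cases : Tri (suc K ℕ.< L) (suc K ≡ L) (L ℕ.< suc K) → b - u * a ≡ δ L (suc K)
  by-cases (tri< 1+K<L _ _) = begin
    b - u * a       ≡⟨ cong₂ (λ x y → x - y * a) (𝟙-yes (K ℕ.<? L) (ℕ.<-trans (ℕ.n<1+n K) 1+K<L))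
                                                 (𝟙-yes (suc K ℕ.<? p) (ℕ.<-≤-trans 1+K<L L≤p)) ⟩
    1ℚ - 1ℚ * a     ≡⟨ cong (λ y → 1ℚ - 1ℚ * y) (𝟙-yes (suc K ℕ.<? L) 1+K<L) ⟩
    0ℚ              ≡⟨ 𝟙-no (L ℕ.≟ suc K) (λ L≡1+K → ℕ.<-irrefl (sym L≡1+K) 1+K<L) ⟨
    δ L (suc K)     ∎
  by-cases (tri≈ _ refl _) = begin
    b - u * a
      ≡⟨ cong₂ (λ x y → x - u * y) (𝟙-yes (K ℕ.<? suc K) (ℕ.n<1+n K)) (𝟙-no (suc K ℕ.<? suc K) (ℕ.<-irrefl refl)) ⟩
    1ℚ - u * 0ℚ
      ≡⟨ 1-u*0≡1 u ⟩
    1ℚ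
      ≡⟨ 𝟙-yes (suc K ℕ.≟ suc K) refl ⟨
    δ (suc K) (suc K) ∎
  by-cases (tri> _ _ L<1+K) = begin
    b - u * a
      ≡⟨ cong₂ (λ x y → x - u * y) (𝟙-no (K ℕ.<? L) (ℕ.≤⇒≯ (ℕ.≤-pred L<1+K))) (𝟙-no (suc K ℕ.<? L) (ℕ.<-asym L<1+K)) ⟩
    0ℚ - u * 0ℚ
      ≡⟨ 0-u*0≡0 u ⟩
    0ℚ
      ≡⟨ 𝟙-no (L ℕ.≟ suc K) (λ L≡1+K → ℕ.<-irrefl L≡1+K L<1+K) ⟨
    δ L (suc K) ∎

-- The two top edges give level p exactly the weight that a further rung would, so the weight does not
-- depend on p.
antiWeight : ℕ → ℚ
antiWeight zero    = + 4 / 1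
antiWeight (suc K) = (+ 6 / 1) * 2^ suc K

localLaplacian-antisymmetric : ∀ p (τ : ℕ → ℚ) K b → K ℕ.≤ p →
  localLaplacian p (λ K x → sign x * τ K) K b ≡ sign b * (antiWeight K * τ K)
localLaplacian-antisymmetric zero τ zero b _ = lemma (spoke (2^ 1) (λ K x → sign x * τ K) 0 1 b) (sign b) (τ 0)
  where
  lemma : ∀ X s t → 0ℚ * X + 0ℚ + 1ℚ * ((1ℚ + 1ℚ) * (s * (1ℚ * t - - 1ℚ * t))) ≡ s * ((+ 4 / 1) * t)
  lemma = solve-∀ ℚ-ring
localLaplacian-antisymmetric (suc p) τ zero b _ =
  lemma (sign b) (τ 0) (τ 1) ((2^ suc p + 2^ suc p) * (sign b * (1ℚ * τ (suc p) - - 1ℚ * τ (suc p))))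
  where
  lemma : ∀ s t₀ t₁ Y → 1ℚ * ((+ 2 / 1) * ((s * t₀ - 1ℚ * t₁) + (s * t₀ - - 1ℚ * t₁))) + 0ℚ + 0ℚ * Y ≡ s * ((+ 4 / 1) * t₀)
  lemma = solve-∀ ℚ-ring
localLaplacian-antisymmetric p τ (suc K) b 1+K≤p = begin
  localLaplacian p Ψ (suc K) b
    ≡⟨ expand u (2^ suc (suc K)) (2^ suc K) (sign b) (τ K) (τ (suc K)) (τ (suc (suc K))) d (2^ p) (τ p) ⟩
  sign b * (τ (suc K) * (u * (2^ suc (suc K) + 2^ suc (suc K)) + (2^ suc K + 2^ suc K)) + d * ((2^ p + 2^ p) * (τ p + τ p)))
    ≡⟨ cong (λ c → sign b * (τ (suc K) * (u * (c + c) + (2^ suc K + 2^ suc K)) + d * ((2^ p + 2^ p) * (τ p + τ p))))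
            (2^suc (suc K)) ⟩
  sign b * (τ (suc K) * (u * ((+ 2 / 1) * 2^ suc K + (+ 2 / 1) * 2^ suc K) + (2^ suc K + 2^ suc K)) + d * ((2^ p + 2^ p) * (τ p + τ p)))
    ≡⟨ cong (sign b *_) (by-cases p (ℕ.m≤n⇒m<n∨m≡n 1+K≤p)) ⟩
  sign b * ((+ 6 / 1) * 2^ suc K * τ (suc K)) ∎
  where
  Ψ = λ K x → sign x * τ K
  u = 𝟙 (does (suc K ℕ.<? p))
  d = δ p (suc K)
  expand : ∀ u c₁ c₀ s t₀ t₁ t₂ d cₚ tₚ →
    u * (c₁ * ((s * t₁ - 1ℚ * t₂) + (s * t₁ - - 1ℚ * t₂))) + c₀ * ((s * t₁ - 1ℚ * t₀) + (s * t₁ - - 1ℚ * t₀))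
      + d * ((cₚ + cₚ) * (s * (1ℚ * tₚ - - 1ℚ * tₚ)))
    ≡ s * (t₁ * (u * (c₁ + c₁) + (c₀ + c₀)) + d * ((cₚ + cₚ) * (tₚ + tₚ)))
  expand = solve-∀ ℚ-ring
  by-cases : ∀ p′ → suc K ℕ.< p′ ⊎ suc K ≡ p′ → let u = 𝟙 (does (suc K ℕ.<? p′)) ; d = δ p′ (suc K) in
    τ (suc K) * (u * ((+ 2 / 1) * 2^ suc K + (+ 2 / 1) * 2^ suc K) + (2^ suc K + 2^ suc K)) + d * ((2^ p′ + 2^ p′) * (τ p′ + τ p′))
    ≡ (+ 6 / 1) * 2^ suc K * τ (suc K)
  by-cases p′ (inj₁ 1+K<p′) =
    trans (cong₂ (λ u d → τ (suc K) * (u * ((+ 2 / 1) * 2^ suc K + (+ 2 / 1) * 2^ suc K) + (2^ suc K + 2^ suc K))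
                            + d * ((2^ p′ + 2^ p′) * (τ p′ + τ p′)))
                 (𝟙-yes (suc K ℕ.<? p′) 1+K<p′) (𝟙-no (p′ ℕ.≟ suc K) (λ p′≡1+K → ℕ.<-irrefl (sym p′≡1+K) 1+K<p′)))
          (lemma (τ (suc K)) (2^ suc K) ((2^ p′ + 2^ p′) * (τ p′ + τ p′)))
    where
    lemma : ∀ t c X → t * (1ℚ * ((+ 2 / 1) * c + (+ 2 / 1) * c) + (c + c)) + 0ℚ * X ≡ (+ 6 / 1) * c * t
    lemma = solve-∀ ℚ-ring
  by-cases .(suc K) (inj₂ refl) =
    trans (cong₂ (λ u d → τ (suc K) * (u * ((+ 2 / 1) * 2^ suc K + (+ 2 / 1) * 2^ suc K) + (2^ suc K + 2^ suc K))
                            + d * ((2^ suc K + 2^ suc K) * (τ (suc K) + τ (suc K))))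
                 (𝟙-no (suc K ℕ.<? suc K) (ℕ.<-irrefl refl)) (𝟙-yes (suc K ℕ.≟ suc K) refl))
          (lemma (τ (suc K)) (2^ suc K) ((+ 2 / 1) * 2^ suc K + (+ 2 / 1) * 2^ suc K))
    where
    lemma : ∀ t c Y → t * (0ℚ * Y + (c + c)) + 1ℚ * ((c + c) * (t + t)) ≡ (+ 6 / 1) * c * t
    lemma = solve-∀ ℚ-ring

antiWeight⁻¹ : ℕ → ℚ
antiWeight⁻¹ zero    = + 1 / 4
antiWeight⁻¹ (suc K) = (+ 1 / 6) * 2^- suc K

antiWeight*antiWeight⁻¹ : ∀ K → antiWeight K * antiWeight⁻¹ K ≡ 1ℚ
antiWeight*antiWeight⁻¹ zero    = refl
antiWeight*antiWeight⁻¹ (suc K) = trans (lemma (2^ suc K) (2^- suc K)) (2^-*2^ (suc K))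
  where
  lemma : ∀ c h → (+ 6 / 1) * c * ((+ 1 / 6) * h) ≡ h * c
  lemma = solve-∀ ℚ-ring

antiPotential : ℕ → Fin 2 → ℕ → ℚ
antiPotential L b′ K = ½ * (δ L K * sign b′ - δ 0 K) * antiWeight⁻¹ K

-- Column (L, b′) of the grounded potential.  Its side-symmetric part carries a current ½ through each
-- side of every rung below level L; its antisymmetric part is solved level by level.
potential : ℕ → Fin 2 → ℕ → Fin 2 → ℚ
potential L b′ K b = A (K ℕ.⊓ L) + sign b * antiPotential L b′ K

localLaplacian-potential : ∀ p L b′ K b → L ℕ.≤ p → K ℕ.≤ p →
  localLaplacian p (λ K _ → A (K ℕ.⊓ L)) K b + localLaplacian p (λ K x → sign x * antiPotential L b′ K) K b
    ≡ δ L K * 𝟙 (b′ == b) - δ 0 K * 𝟙 (zero == b)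
localLaplacian-potential p L b′ K b L≤p K≤p = begin
  _ ≡⟨ cong₂ _+_ (trans (localLaplacian-symmetric p (λ t → A (t ℕ.⊓ L)) K b) (pathLaplacian-A p L K L≤p))
                 (localLaplacian-antisymmetric p (antiPotential L b′) K b K≤p) ⟩
  ½ * (x - y) + sign b * (w * (½ * (x * sign b′ - y) * w⁻¹))
    ≡⟨ cong (λ t → ½ * (x - y) + sign b * t) (trans (lemma w (½ * (x * sign b′ - y)) w⁻¹)
                                                   (trans (cong (½ * (x * sign b′ - y) *_) (antiWeight*antiWeight⁻¹ K))
                                                          (*-identityʳ _))) ⟩
  ½ * (x - y) + sign b * (½ * (x * sign b′ - y))
    ≡⟨ combine b b′ x y ⟩
  x * 𝟙 (b′ == b) - y * 𝟙 (zero == b) ∎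
  where
  x = δ L K
  y = δ 0 K
  w = antiWeight K
  w⁻¹ = antiWeight⁻¹ K
  lemma : ∀ w t w⁻¹ → w * (t * w⁻¹) ≡ t * (w * w⁻¹)
  lemma = solve-∀ ℚ-ring
  combine : ∀ b b′ x y → ½ * (x - y) + sign b * (½ * (x * sign b′ - y)) ≡ x * 𝟙 (b′ == b) - y * 𝟙 (zero == b)
  combine zero       zero       = solve-∀ ℚ-ring
  combine zero       (suc zero) = solve-∀ ℚ-ring
  combine (suc zero) zero       = solve-∀ ℚ-ring
  combine (suc zero) (suc zero) = solve-∀ ℚ-ring

level : ∀ n → Fin (n ℕ.* 2) → ℕ
level n i = toℕ (quotient {n} 2 i)

side : ∀ n → Fin (n ℕ.* 2) → Fin 2
side n i = remainder {n} 2 i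

level-vtx : ∀ {n} (k : Fin n) b → level n (vtx k b) ≡ toℕ k
level-vtx k b = cong (toℕ ∘ proj₁) (Fin.remQuot-combine k b)

side-vtx : ∀ {n} (k : Fin n) b → side n (vtx k b) ≡ b
side-vtx k b = cong proj₂ (Fin.remQuot-combine k b)

vtx-level-side : ∀ {n} (i : Fin (n ℕ.* 2)) → i ≡ vtx (quotient {n} 2 i) (side n i)
vtx-level-side {n} i = sym (Fin.combine-remQuot {n} 2 i)

Φ : ∀ p → Matrix (suc p ℕ.* 2)
Φ p i j = potential (level (suc p) j) (side (suc p) j) (level (suc p) i) (side (suc p) i)

Φ-grounded : ∀ p j i → (laplacian (𝔾 p) *ᵥ (λ a → Φ p a j)) i ≡ basis j i - basis zero i
Φ-grounded p j i = subst (λ i → (laplacian (𝔾 p) *ᵥ (λ a → Φ p a j)) i ≡ basis j i - basis zero i)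
                         (sym (vtx-level-side i)) (column (quotient {suc p} 2 i) (side (suc p) i))
  where
  l = quotient {suc p} 2 j
  L = toℕ l
  b′ = side (suc p) j
  σ̂ τ̂ : Vector ℚ (suc p ℕ.* 2)
  σ̂ a = A (level (suc p) a ℕ.⊓ L)
  τ̂ a = sign (side (suc p) a) * antiPotential L b′ (level (suc p) a)
  column : ∀ k b → (laplacian (𝔾 p) *ᵥ (λ a → Φ p a j)) (vtx k b) ≡ basis j (vtx k b) - basis zero (vtx k b)
  column k b = begin
    (laplacian (𝔾 p) *ᵥ (λ a → σ̂ a + τ̂ a)) (vtx k b)
      ≡⟨ *ᵥ-distrib-+ (laplacian (𝔾 p)) σ̂ τ̂ (vtx k b) ⟩
    (laplacian (𝔾 p) *ᵥ σ̂) (vtx k b) + (laplacian (𝔾 p) *ᵥ τ̂) (vtx k b)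
      ≡⟨ cong₂ _+_ (laplacian-𝔾 p σ̂ (λ K _ → A (K ℕ.⊓ L)) (λ k x → cong (λ t → A (t ℕ.⊓ L)) (level-vtx k x)) k b K≤p)
                   (laplacian-𝔾 p τ̂ (λ K x → sign x * antiPotential L b′ K)
                      (λ k x → cong₂ (λ s t → sign s * antiPotential L b′ t) (side-vtx k x) (level-vtx k x)) k b K≤p) ⟩
    localLaplacian p (λ K _ → A (K ℕ.⊓ L)) K b + localLaplacian p (λ K x → sign x * antiPotential L b′ K) K b
      ≡⟨ localLaplacian-potential p L b′ K b (Fin.toℕ≤pred[n] l) K≤p ⟩
    δ L K * 𝟙 (b′ == b) - δ 0 K * 𝟙 (zero == b)
      ≡⟨ cong₂ _-_ (𝟙-vtx l k b′ b) (𝟙-vtx zero k zero b) ⟨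
    basis (vtx l b′) (vtx k b) - basis zero (vtx k b)
      ≡⟨ cong (λ j → basis j (vtx k b) - basis zero (vtx k b)) (vtx-level-side {suc p} j) ⟨
    basis j (vtx k b) - basis zero (vtx k b) ∎
    where
    K = toℕ k
    K≤p = Fin.toℕ≤pred[n] k

-- Trace and entry sum of the potential

∑-vtx : ∀ n (f : Vector ℚ (n ℕ.* 2)) → sum f ≡ sum {n} (λ k → f (vtx k zero) + f (vtx k (suc zero)))
∑-vtx zero    f = refl
∑-vtx (suc n) f = trans (cong (λ t → f zero + (f (suc zero) + t)) (∑-vtx n (λ i → f (suc (suc i)))))
                        (sym (ℚ.+-assoc (f zero) (f (suc zero)) (sum {n} (λ k → f′ (vtx k zero) + f′ (vtx k (suc zero))))))
  where
  f′ = λ i → f (suc (suc i))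

block : ∀ {n} → Matrix (n ℕ.* 2) → Fin n → Fin n → ℚ
block F k l = (F (vtx k zero) (vtx l zero) + F (vtx k zero) (vtx l (suc zero)))
            + (F (vtx k (suc zero)) (vtx l zero) + F (vtx k (suc zero)) (vtx l (suc zero)))

∑∑-vtx : ∀ n (F : Matrix (n ℕ.* 2)) → sumEntries F ≡ sum {n} (λ k → sum {n} (λ l → block F k l))
∑∑-vtx n F = begin
  sum (λ i → sum (F i))
    ≡⟨ ∑-vtx n (λ i → sum (F i)) ⟩
  sum {n} (λ k → sum (F (vtx k zero)) + sum (F (vtx k (suc zero))))
    ≡⟨ sum-cong-≗ (λ (k : Fin n) → cong₂ _+_ (∑-vtx n (F (vtx k zero))) (∑-vtx n (F (vtx k (suc zero))))) ⟩
  sum {n} (λ k → sum {n} (row k zero) + sum {n} (row k (suc zero)))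
    ≡⟨ sum-cong-≗ (λ (k : Fin n) → ∑-distrib-+ (row k zero) (row k (suc zero))) ⟨
  sum {n} (λ k → sum {n} (λ l → block F k l)) ∎
  where
  row : Fin n → Fin 2 → Fin n → ℚ
  row k b l = F (vtx k b) (vtx l zero) + F (vtx k b) (vtx l (suc zero))

∑-toℕ-last : ∀ n (F : ℕ → ℚ) → sum {suc n} (λ k → F (toℕ k)) ≡ sum {n} (λ k → F (toℕ k)) + F n
∑-toℕ-last n F = trans (sum-init-last (λ (k : Fin (suc n)) → F (toℕ k)))
  (cong₂ _+_ (sum-cong-≗ (λ (k : Fin n) → cong F (Fin.toℕ-inject₁ k))) (cong F (Fin.toℕ-fromℕ n)))

Φ-vtx : ∀ p (k l : Fin (suc p)) b b′ → Φ p (vtx k b) (vtx l b′) ≡ potential (toℕ l) b′ (toℕ k) b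
Φ-vtx p k l b b′ = cong₂ (λ x y → potential (toℕ (proj₁ y)) (proj₂ y) (toℕ (proj₁ x)) (proj₂ x))
                         (Fin.remQuot-combine k b) (Fin.remQuot-combine l b′)

levelTrace : ℕ → ℚ
levelTrace K = A K + A K + antiWeight⁻¹ K

trace-Φ-by-levels : ∀ p → trace (Φ p) ≡ sum {suc p} (λ k → levelTrace (toℕ k))
trace-Φ-by-levels p = trans (∑-vtx (suc p) (λ i → Φ p i i)) (sum-cong-≗ diagonal)
  where
  diagonal : ∀ k → Φ p (vtx k zero) (vtx k zero) + Φ p (vtx k (suc zero)) (vtx k (suc zero))
                   ≡ levelTrace (toℕ k)
  diagonal k = begin
    Φ p (vtx k zero) (vtx k zero) + Φ p (vtx k (suc zero)) (vtx k (suc zero))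
      ≡⟨ cong₂ _+_ (Φ-vtx p k k zero zero) (Φ-vtx p k k (suc zero) (suc zero)) ⟩
    potential K zero K zero + potential K (suc zero) K (suc zero)
      ≡⟨ cong₂ (λ m x → A m + 1ℚ * (½ * (x * 1ℚ - y) * w) + (A m + - 1ℚ * (½ * (x * - 1ℚ - y) * w)))
               (ℕ.⊓-idem K) (𝟙-yes (K ℕ.≟ K) refl) ⟩
    A K + 1ℚ * (½ * (1ℚ * 1ℚ - y) * w) + (A K + - 1ℚ * (½ * (1ℚ * - 1ℚ - y) * w))
      ≡⟨ lemma (A K) y w ⟩
    A K + A K + w ∎
    where
    K = toℕ k
    y = δ 0 K
    w = antiWeight⁻¹ K
    lemma : ∀ a y w → a + 1ℚ * (½ * (1ℚ * 1ℚ - y) * w) + (a + - 1ℚ * (½ * (1ℚ * - 1ℚ - y) * w)) ≡ a + a + w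
    lemma = solve-∀ ℚ-ring

sumEntries-Φ-by-levels : ∀ p → sumEntries (Φ p) ≡ (+ 4 / 1) * sum {suc p} (λ k → sum {suc p} (λ l → A (toℕ k ℕ.⊓ toℕ l)))
sumEntries-Φ-by-levels p = begin
  sumEntries (Φ p)                                   ≡⟨ ∑∑-vtx (suc p) (Φ p) ⟩
  sum {suc p} (λ k → sum (λ l → block (Φ p) k l))    ≡⟨ sum-cong-≗ (λ k → sum-cong-≗ (block-Φ k)) ⟩
  sum {suc p} (λ k → sum (λ l → (+ 4 / 1) * A′ k l)) ≡⟨ sum-cong-≗ (λ k → *-distribˡ-sum (+ 4 / 1) (A′ k)) ⟨
  sum {suc p} (λ k → (+ 4 / 1) * sum (A′ k))         ≡⟨ *-distribˡ-sum (+ 4 / 1) (λ k → sum (A′ k)) ⟨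
  (+ 4 / 1) * sum {suc p} (λ k → sum (A′ k))         ∎
  where
  A′ : Fin (suc p) → Fin (suc p) → ℚ
  A′ k l = A (toℕ k ℕ.⊓ toℕ l)
  block-Φ : ∀ (k l : Fin (suc p)) → block (Φ p) k l ≡ (+ 4 / 1) * A′ k l
  block-Φ k l = begin
    block (Φ p) k l
      ≡⟨ cong₂ _+_ (cong₂ _+_ (Φ-vtx p k l zero zero) (Φ-vtx p k l zero (suc zero)))
                   (cong₂ _+_ (Φ-vtx p k l (suc zero) zero) (Φ-vtx p k l (suc zero) (suc zero))) ⟩
    (potential L zero K zero + potential L (suc zero) K zero)
    + (potential L zero K (suc zero) + potential L (suc zero) K (suc zero))
      ≡⟨ lemma (A (K ℕ.⊓ L)) (antiPotential L zero K) (antiPotential L (suc zero) K) ⟩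
    (+ 4 / 1) * A (K ℕ.⊓ L) ∎
    where
    K = toℕ k
    L = toℕ l
    lemma : ∀ a t₀ t₁ → a + 1ℚ * t₀ + (a + 1ℚ * t₁) + (a + - 1ℚ * t₀ + (a + - 1ℚ * t₁)) ≡ (+ 4 / 1) * a
    lemma = solve-∀ ℚ-ring

A-suc : ∀ t → A (suc t) ≡ (+ 1 / 8) + ½ * A t
A-suc t = trans (cong (λ h → (1ℚ - h) * (+ 1 / 4)) (2^-suc t)) (lemma (2^- t))
  where
  lemma : ∀ h → (1ℚ - ½ * h) * (+ 1 / 4) ≡ (+ 1 / 8) + ½ * ((1ℚ - h) * (+ 1 / 4))
  lemma = solve-∀ ℚ-ring

∑-levelTrace : ∀ p → sum {suc p} (λ k → levelTrace (toℕ k))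
                       ≡ (+ p / 1) * ½ - (+ 1 / 12) + 2^- p * (+ 1 / 3)
∑-levelTrace zero    = refl
∑-levelTrace (suc p) = begin
  sum {suc (suc p)} (λ k → levelTrace (toℕ k))
    ≡⟨ ∑-toℕ-last (suc p) levelTrace ⟩
  sum {suc p} (λ k → levelTrace (toℕ k)) + levelTrace (suc p)
    ≡⟨ cong (_+ levelTrace (suc p)) (∑-levelTrace p) ⟩
  x * ½ - (+ 1 / 12) + h * (+ 1 / 3) + ((1ℚ - 2^- suc p) * (+ 1 / 4) + (1ℚ - 2^- suc p) * (+ 1 / 4) + (+ 1 / 6) * 2^- suc p)
    ≡⟨ cong (λ h′ → x * ½ - (+ 1 / 12) + h * (+ 1 / 3) + ((1ℚ - h′) * (+ 1 / 4) + (1ℚ - h′) * (+ 1 / 4) + (+ 1 / 6) * h′))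
            (2^-suc p) ⟩
  x * ½ - (+ 1 / 12) + h * (+ 1 / 3) + ((1ℚ - ½ * h) * (+ 1 / 4) + (1ℚ - ½ * h) * (+ 1 / 4) + (+ 1 / 6) * (½ * h))
    ≡⟨ lemma x h ⟩
  (1ℚ + x) * ½ - (+ 1 / 12) + (½ * h) * (+ 1 / 3)
    ≡⟨ cong₂ (λ y h′ → y * ½ - (+ 1 / 12) + h′ * (+ 1 / 3)) (/1-homo-+ 1 p) (2^-suc p) ⟨
  (+ suc p / 1) * ½ - (+ 1 / 12) + 2^- suc p * (+ 1 / 3) ∎
  where
  x = + p / 1
  h = 2^- p
  lemma : ∀ x h → x * ½ - (+ 1 / 12) + h * (+ 1 / 3) + ((1ℚ - ½ * h) * (+ 1 / 4) + (1ℚ - ½ * h) * (+ 1 / 4) + (+ 1 / 6) * (½ * h))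
                  ≡ (1ℚ + x) * ½ - (+ 1 / 12) + (½ * h) * (+ 1 / 3)
  lemma = solve-∀ ℚ-ring

∑∑-A-min : ∀ p → sum {suc p} (λ k → sum {suc p} (λ l → A (toℕ k ℕ.⊓ toℕ l)))
                   ≡ ((+ p / 1) * (+ p / 1) - (+ 2 / 1) * (+ p / 1) + (+ 3 / 1) - (+ 3 / 1) * 2^- p) * (+ 1 / 4)
∑∑-A-min zero    = refl
∑∑-A-min (suc p) = begin
  sum {suc (suc p)} (λ l → A (0 ℕ.⊓ toℕ l)) + sum {suc p} (λ k → sum {suc (suc p)} (λ l → A (suc (toℕ k) ℕ.⊓ toℕ l)))
    ≡⟨ cong₂ _+_ (sum-replicate-zero (suc (suc p))) (sum-cong-≗ (λ (k : Fin (suc p)) → row (toℕ k))) ⟩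
  0ℚ + sum {suc p} (λ k → (+ suc p / 1) * (+ 1 / 8) + ½ * S (toℕ k))
    ≡⟨ +-identityˡ (sum {suc p} (λ k → (+ suc p / 1) * (+ 1 / 8) + ½ * S (toℕ k))) ⟩
  sum {suc p} (λ k → (+ suc p / 1) * (+ 1 / 8) + ½ * S (toℕ k))
    ≡⟨ ∑-distrib-+ (λ (_ : Fin (suc p)) → (+ suc p / 1) * (+ 1 / 8)) (λ k → ½ * S (toℕ k)) ⟩
  sum {suc p} (λ _ → (+ suc p / 1) * (+ 1 / 8)) + sum {suc p} (λ k → ½ * S (toℕ k))
    ≡⟨ cong₂ _+_ (∑-const (suc p) ((+ suc p / 1) * (+ 1 / 8))) (sym (*-distribˡ-sum ½ (λ (k : Fin (suc p)) → S (toℕ k)))) ⟩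
  (+ suc p / 1) * ((+ suc p / 1) * (+ 1 / 8)) + ½ * sum {suc p} (λ k → S (toℕ k))
    ≡⟨ cong (λ t → (+ suc p / 1) * ((+ suc p / 1) * (+ 1 / 8)) + ½ * t) (∑∑-A-min p) ⟩
  (+ suc p / 1) * ((+ suc p / 1) * (+ 1 / 8)) + ½ * ((x * x - (+ 2 / 1) * x + (+ 3 / 1) - (+ 3 / 1) * h) * (+ 1 / 4))
    ≡⟨ cong (λ y → y * (y * (+ 1 / 8)) + ½ * ((x * x - (+ 2 / 1) * x + (+ 3 / 1) - (+ 3 / 1) * h) * (+ 1 / 4))) (/1-homo-+ 1 p) ⟩
  (1ℚ + x) * ((1ℚ + x) * (+ 1 / 8)) + ½ * ((x * x - (+ 2 / 1) * x + (+ 3 / 1) - (+ 3 / 1) * h) * (+ 1 / 4))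
    ≡⟨ lemma x h ⟩
  ((1ℚ + x) * (1ℚ + x) - (+ 2 / 1) * (1ℚ + x) + (+ 3 / 1) - (+ 3 / 1) * (½ * h)) * (+ 1 / 4)
    ≡⟨ cong₂ (λ y h′ → (y * y - (+ 2 / 1) * y + (+ 3 / 1) - (+ 3 / 1) * h′) * (+ 1 / 4)) (/1-homo-+ 1 p) (2^-suc p) ⟨
  ((+ suc p / 1) * (+ suc p / 1) - (+ 2 / 1) * (+ suc p / 1) + (+ 3 / 1) - (+ 3 / 1) * 2^- suc p) * (+ 1 / 4) ∎
  where
  x = + p / 1
  h = 2^- p
  S : ℕ → ℚ
  S K = sum {suc p} (λ l → A (K ℕ.⊓ toℕ l))
  lemma : ∀ x h → (1ℚ + x) * ((1ℚ + x) * (+ 1 / 8)) + ½ * ((x * x - (+ 2 / 1) * x + (+ 3 / 1) - (+ 3 / 1) * h) * (+ 1 / 4))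
                  ≡ ((1ℚ + x) * (1ℚ + x) - (+ 2 / 1) * (1ℚ + x) + (+ 3 / 1) - (+ 3 / 1) * (½ * h)) * (+ 1 / 4)
  lemma = solve-∀ ℚ-ring
  row : ∀ K → sum {suc (suc p)} (λ l → A (suc K ℕ.⊓ toℕ l)) ≡ (+ suc p / 1) * (+ 1 / 8) + ½ * S K
  row K = begin
    0ℚ + sum {suc p} (λ l → A (suc (K ℕ.⊓ toℕ l)))
      ≡⟨ +-identityˡ (sum {suc p} (λ l → A (suc (K ℕ.⊓ toℕ l)))) ⟩
    sum {suc p} (λ l → A (suc (K ℕ.⊓ toℕ l)))
      ≡⟨ sum-cong-≗ (λ (l : Fin (suc p)) → A-suc (K ℕ.⊓ toℕ l)) ⟩
    sum {suc p} (λ l → (+ 1 / 8) + ½ * A (K ℕ.⊓ toℕ l))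
      ≡⟨ ∑-distrib-+ (λ (_ : Fin (suc p)) → + 1 / 8) (λ l → ½ * A (K ℕ.⊓ toℕ l)) ⟩
    sum {suc p} (λ _ → + 1 / 8) + sum {suc p} (λ l → ½ * A (K ℕ.⊓ toℕ l))
      ≡⟨ cong₂ _+_ (∑-const (suc p) (+ 1 / 8)) (sym (*-distribˡ-sum ½ (λ (l : Fin (suc p)) → A (K ℕ.⊓ toℕ l)))) ⟩
    (+ suc p / 1) * (+ 1 / 8) + ½ * S K ∎

closed-forms-arithmetic : ∀ p → let x = + p / 1 ; h = 2^- p in
  (+ (suc p ℕ.* 2) / 1) * (x * ½ - (+ 1 / 12) + h * (+ 1 / 3))
    - (+ 4 / 1) * ((x * x - (+ 2 / 1) * x + (+ 3 / 1) - (+ 3 / 1) * h) * (+ 1 / 4))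
  ≡ (+ 17 / 6) * (+ suc p / 1) - (+ 6 / 1) + (+ (2 ℕ.* suc p ℕ.+ 9) / 3) * h
closed-forms-arithmetic p = begin
  N * T - S
    ≡⟨ cong (λ y → y * T - S) N≡ ⟩
  ((1ℚ + x) * (+ 2 / 1)) * T - S
    ≡⟨ lemma x h ⟩
  (+ 17 / 6) * (1ℚ + x) - (+ 6 / 1) + (((+ 2 / 1) * (1ℚ + x) + (+ 9 / 1)) * (+ 1 / 3)) * h
    ≡⟨ cong₂ (λ n c → (+ 17 / 6) * n - (+ 6 / 1) + c * h) n≡ c≡ ⟨
  (+ 17 / 6) * (+ suc p / 1) - (+ 6 / 1) + (+ (2 ℕ.* suc p ℕ.+ 9) / 3) * h ∎
  where
  x = + p / 1
  h = 2^- p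
  N = + (suc p ℕ.* 2) / 1
  T = x * ½ - (+ 1 / 12) + h * (+ 1 / 3)
  S = (+ 4 / 1) * ((x * x - (+ 2 / 1) * x + (+ 3 / 1) - (+ 3 / 1) * h) * (+ 1 / 4))
  n≡ : + suc p / 1 ≡ 1ℚ + x
  n≡ = /1-homo-+ 1 p
  N≡ : N ≡ (1ℚ + x) * (+ 2 / 1)
  N≡ = trans (/1-homo-* (suc p) 2) (cong (_* (+ 2 / 1)) n≡)
  c≡ : + (2 ℕ.* suc p ℕ.+ 9) / 3 ≡ ((+ 2 / 1) * (1ℚ + x) + (+ 9 / 1)) * (+ 1 / 3)
  c≡ = trans (/3≡/1*⅓ (2 ℕ.* suc p ℕ.+ 9)) (cong (_* (+ 1 / 3)) (trans (/1-homo-+ (2 ℕ.* suc p) 9)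
         (cong (λ t → t + (+ 9 / 1)) (trans (/1-homo-* 2 (suc p)) (cong ((+ 2 / 1) *_) n≡)))))
  lemma : ∀ x h → ((1ℚ + x) * (+ 2 / 1)) * (x * ½ - (+ 1 / 12) + h * (+ 1 / 3))
                    - (+ 4 / 1) * ((x * x - (+ 2 / 1) * x + (+ 3 / 1) - (+ 3 / 1) * h) * (+ 1 / 4))
                  ≡ (+ 17 / 6) * (1ℚ + x) - (+ 6 / 1) + (((+ 2 / 1) * (1ℚ + x) + (+ 9 / 1)) * (+ 1 / 3)) * h
  lemma = solve-∀ ℚ-ring

theorem3p2 : (p : ℕ) → let n = suc p in
    (X : Matrix (n Data.Nat.* 2)) → IsMoorePenroseInverse (laplacian (𝔾 p)) X →
      kirchhoffIndex X ≡ (+ 17 / 6) * (+ n / 1) - (+ 6 / 1) + (+ (2 Data.Nat.* n Data.Nat.+ 9) / 3) * (2^- p)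
theorem3p2 p X X-MP = begin
  kirchhoffIndex X
    ≡⟨ kirchhoffIndex-grounded {L = laplacian (𝔾 p)} {X} (laplacian-symmetric (𝔾 p)) (IsMoorePenroseInverse.penrose₁ X-MP)
                               (Φ p) zero (Φ-grounded p) ⟩
  (+ (suc p ℕ.* 2) / 1) * trace (Φ p) - sumEntries (Φ p)
    ≡⟨ cong₂ (λ t s → (+ (suc p ℕ.* 2) / 1) * t - s) (trans (trace-Φ-by-levels p) (∑-levelTrace p))
                                                     (trans (sumEntries-Φ-by-levels p) (cong ((+ 4 / 1) *_) (∑∑-A-min p))) ⟩
  _
    ≡⟨ closed-forms-arithmetic p ⟩
  (+ 17 / 6) * (+ suc p / 1) - (+ 6 / 1) + (+ (2 ℕ.* suc p ℕ.+ 9) / 3) * 2^- p ∎
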